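{- (a) For all $n\ge2$ and all $N\in\Gamma_{2n}$ one has $c_{ -2n+3}(N)=0$. (b) For all $n\ge2$: $c_{ -2n+1}(N)=1$ for the first (smallest) $L_{2n-1}$ numbers $N$ of $\Gamma_{2n+1}$, and $c_{ -2n+1}(N)=0$ for the last (largest) $L_{2n-2}$ numbers $N$ of $\Gamma_{2n+1}$.
   Context: Let $\varphi=(1+\sqrt5)/2$. Lucas numbers: $L_0=2$, $L_1=1$, $L_n=L_{n-1}+L_{n-2}$. Canonical Lucas intervals: $\Gamma_0=\{1\}$, $\Gamma_n=[L_n+1,L_{n+1}]\cap\mathbb Z$ for $n\ge1$ (so $|\Gamma_{2n+1}|=L_{2n}=L_{2n-1}+L_{2n-2}$). The Bergman representation $\beta(N)$ is the unique finite expansion $N=\sum_i d_i\varphi^i$ with digits in $\{0,1\}$ and no two consecutive digits $11$. The canonical representation $\gamma(N)$: if $N$ has a finite representation $N=\sum_ic_i\varphi^i$ with digits in $\{0,1\}$, $c_1=c_0=1$, and $c_{i+1}c_i\ne11$ for all $i\ne0$, then $\gamma(N)$ is this (unique) representation; otherwise $\gamma(N)=\beta(N)$. $c_i(N)$ denotes the digit of index $i$ in $\gamma(N)$ (equal to $0$ for indices outside the range of nonzero digits). -}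

module Defs where

open import Data.Nat as ℕ using (ℕ; zero; suc)
open import Data.Integer as ℤ using (ℤ; +_; -[1+_])
open import Data.Bool using (Bool; true; false)
open import Data.List using (List; []; _∷_)
open import Data.Product using (_×_; _,_; ∃; Σ)
open import Data.Sum using (_⊎_)
open import Relation.Nullary using (¬_)
open import Relation.Binary.PropositionalEquality using (_≡_; _≢_)

L : ℕ → ℕ
L zero = 2
L (suc zero) = 1
L (suc (suc n)) = L (suc n) ℕ.+ L n

-- Elements of ℤ[φ], the pair (a , b) standing for a + b φ  (φ² = φ + 1).
ℤφ : Set
ℤφ = ℤ × ℤ

zeroφ : ℤφ
zeroφ = (+ 0 , + 0)

_+φ_ : ℤφ → ℤφ → ℤφ
(a , b) +φ (c , d) = (a ℤ.+ c , b ℤ.+ d)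

-- multiplication by φ : (a + bφ)φ = b + (a+b)φ
mulφ : ℤφ → ℤφ
mulφ (a , b) = (b , a ℤ.+ b)

-- multiplication by φ⁻¹ = φ - 1 : (a + bφ)(φ - 1) = (b - a) + aφ
divφ : ℤφ → ℤφ
divφ (a , b) = (b ℤ.- a , a)

iter : ℕ → (ℤφ → ℤφ) → ℤφ → ℤφ
iter zero f x = x
iter (suc k) f x = f (iter k f x)

scaleφ : ℤ → ℤφ → ℤφ
scaleφ (+ k) x = iter k mulφ x
scaleφ -[1+ k ] x = iter (suc k) divφ x

-- A finite φ-expansion with digits in {0,1}: the digit list ds is placed at
-- indices low, low+1, low+2, ... (all other digits are 0).
record Rep : Set where
  constructor rep
  field
    low    : ℤ
    digits : List Bool
open Rep public

bitℤ : Bool → ℤ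
bitℤ true = + 1
bitℤ false = + 0

horner : List Bool → ℤφ
horner [] = zeroφ
horner (d ∷ ds) = (bitℤ d , + 0) +φ mulφ (horner ds)

value : Rep → ℤφ
value r = scaleφ (low r) (horner (digits r))

nth : List Bool → ℕ → Bool
nth [] _ = false
nth (d ∷ ds) zero = d
nth (d ∷ ds) (suc k) = nth ds k

digit : Rep → ℤ → Bool
digit r i with i ℤ.- low r
... | + k = nth (digits r) k
... | -[1+ _ ] = false

Represents : ℕ → Rep → Set
Represents N r = value r ≡ (+ N , + 0)

IsBergman : ℕ → Rep → Set
IsBergman N r = Represents N r ×
  (∀ (i : ℤ) → ¬ (digit r i ≡ true × digit r (i ℤ.+ + 1) ≡ true))

IsSpecial : ℕ → Rep → Set
IsSpecial N r = Represents N r × digit r (+ 1) ≡ true × digit r (+ 0) ≡ true ×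
  (∀ (i : ℤ) → i ≢ + 0 → ¬ (digit r i ≡ true × digit r (i ℤ.+ + 1) ≡ true))

IsCanonical : ℕ → Rep → Set
IsCanonical N r = IsSpecial N r ⊎ ((¬ ∃ λ s → IsSpecial N s) × IsBergman N r)

-- c_i(N) = b : γ(N) exists and every canonical representation of N
-- (unique up to padding by zeros) has digit b at index i
CDigit : ℕ → ℤ → Bool → Set
CDigit N i b = (∃ λ r → IsCanonical N r) × (∀ r → IsCanonical N r → digit r i ≡ b)

-- Below index 0 the canonical representation γ(N) agrees with the Bergman
-- representation β(N).  A special representation becomes β(N) by carrying its
-- block 1 1 at indices 0, 1 upwards (φ^q + φ^(q+1) = φ^(q+2)), which never moves a
-- negative digit, and β(N) is unique: shifted to positions ≥ 2 and read through
-- the coordinates of φ^p = F(p-1) + F(p)·φ, it is a Zeckendorf expansion.  The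
-- carrying can be undone exactly when β(N) reads … 0 | 0 0 … 0 0 1 around index 0,
-- which makes the existence of a special representation decidable.
--
-- It remains to compute β(N) in the Lucas intervals, by induction on n, from
-- φ^(2n) + φ^(-2n) = L(2n) and φ^(2n+1) - φ^(-2n-1) = L(2n+1).  For
-- 1 ≤ M ≤ L(2n-1), β(L(2n) + M) = φ^(-2n) + β(M) + φ^(2n), where the lowest
-- exponent of β(M) is even and at least -2n+2, so the digit at -2n+3 vanishes.
-- For 1 ≤ M < L(2n), β(L(2n+1) + M) arises from β(M) by replacing its lowest term
-- φ^(-2n+2d) with φ^(-2n-2) + φ^(-2n+1) + φ^(-2n+3) + … + φ^(-2n+2d-1) and adding
-- φ^(2n+1); its digit at -2n+1 is 1 exactly when d ≥ 1, i.e. when M ≤ L(2n-1).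

module Submission where

open import Defs
open import Data.Nat using (ℕ; _+_; _*_; _∸_; _≤_; _<_)
open import Data.Integer using (+_; _-_)
open import Data.Bool using (true; false)
open import Data.Product using (_×_)

open import Data.Bool using (Bool)
open import Data.Bool.Properties using () renaming (_≟_ to _≟ᵇ_)
open import Data.Empty using (⊥-elim)
open import Data.Integer using (ℤ; -[1+_])
import Data.Integer as ℤ
import Data.Integer.Properties as ℤP
open import Data.Integer.Tactic.RingSolver using () renaming (solve-∀ to solve-∀ℤ)
open import Data.List using (List; []; _∷_; _++_; replicate; length; applyUpTo; map)
open import Data.List.Properties using (map-++)
open import Data.Nat using (zero; suc; pred; z≤n; s≤s; _≟_; _<?_)
open import Data.Nat.ListAction using (sum)
open import Data.Nat.ListAction.Properties using (sum-++)
open import Data.Nat.Properties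
open import Data.Nat.Tactic.RingSolver using (solve-∀)
open import Data.Product using (Σ; ∃; _,_; proj₁; proj₂)
open import Data.Sum using (inj₁; inj₂)
open import Function using (_∘_)
open import Relation.Binary.PropositionalEquality
open import Relation.Nullary using (¬_; Dec; yes; no)
open import Relation.Nullary.Decidable using (map′; _×-dec_)
open import Algebra.Properties.CommutativeSemigroup +-commutativeSemigroup
  using () renaming (interchange to +-interchange)

true≢false : true ≢ false
true≢false ()

m+2+n≡2+m+n : ∀ m n → m + (2 + n) ≡ 2 + m + n
m+2+n≡2+m+n m n = trans (+-suc m (suc n)) (cong suc (+-suc m n))

n≢1+n : ∀ {n} → n ≢ 1 + n
n≢1+n = ≢-sym 1+n≢n

n≢2+n : ∀ {n} → n ≢ 2 + n
n≢2+n = ≢-sym (m+1+n≢n 1)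

fib : ℕ → ℕ
fib zero = 0
fib (suc zero) = 1
fib (suc (suc n)) = fib (suc n) + fib n

-- fibPrev p = F (p - 1) with F (-1) = 1, so that φ ^ p = fibPrev p + fib p · φ.
fibPrev : ℕ → ℕ
fibPrev zero = 1
fibPrev (suc n) = fib n

FibLike : (ℕ → ℕ) → Set
FibLike w = ∀ p → w (2 + p) ≡ w (1 + p) + w p

fib-fibLike : FibLike fib
fib-fibLike p = refl

fibPrev-fibLike : FibLike fibPrev
fibPrev-fibLike zero = refl
fibPrev-fibLike (suc p) = refl

fib-suc : ∀ p → fib (suc p) ≡ fibPrev p + fib p
fib-suc zero = refl
fib-suc (suc p) = +-comm (fib (suc p)) (fib p)

infixl 7 _·_

_·_ : Bool → ℕ → ℕ
true · x = x
false · x = 0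

·-distribˡ-+ : ∀ b x y → b · (x + y) ≡ b · x + b · y
·-distribˡ-+ true x y = refl
·-distribˡ-+ false x y = refl

·-zeroʳ : ∀ b → b · 0 ≡ 0
·-zeroʳ true = refl
·-zeroʳ false = refl

wsum : (ℕ → ℕ) → (ℕ → Bool) → ℕ → ℕ
wsum w f zero = 0
wsum w f (suc T) = wsum w f T + f T · w T

wsum-cong : ∀ w {f g} T → (∀ p → p < T → f p ≡ g p) → wsum w f T ≡ wsum w g T
wsum-cong w zero f≗g = refl
wsum-cong w (suc T) f≗g =
  cong₂ _+_ (wsum-cong w T (λ p p<T → f≗g p (m<n⇒m<1+n p<T))) (cong (_· w T) (f≗g T (n<1+n T)))

wsum-congʷ : ∀ {w v} f T → (∀ p → w p ≡ v p) → wsum w f T ≡ wsum v f T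
wsum-congʷ f zero w≗v = refl
wsum-congʷ f (suc T) w≗v = cong₂ _+_ (wsum-congʷ f T w≗v) (cong (f T ·_) (w≗v T))

wsum-+ʷ : ∀ w v f T → wsum (λ p → w p + v p) f T ≡ wsum w f T + wsum v f T
wsum-+ʷ w v f zero = refl
wsum-+ʷ w v f (suc T) = begin
  wsum (λ p → w p + v p) f T + f T · (w T + v T)
    ≡⟨ cong₂ _+_ (wsum-+ʷ w v f T) (·-distribˡ-+ (f T) (w T) (v T)) ⟩
  wsum w f T + wsum v f T + (f T · w T + f T · v T)
    ≡⟨ +-interchange (wsum w f T) (wsum v f T) (f T · w T) (f T · v T) ⟩
  wsum w f T + f T · w T + (wsum v f T + f T · v T) ∎
  where open ≡-Reasoning

wsum-suc : ∀ w f T → wsum w f (suc T) ≡ f 0 · w 0 + wsum (w ∘ suc) (f ∘ suc) T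
wsum-suc w f zero = +-comm 0 _
wsum-suc w f (suc T) = trans (cong (_+ f (suc T) · w (suc T)) (wsum-suc w f T)) (+-assoc (f 0 · w 0) _ _)

wsum-false : ∀ w T → wsum w (λ _ → false) T ≡ 0
wsum-false w zero = refl
wsum-false w (suc T) = cong (_+ 0) (wsum-false w T)

Vanishes : ℕ → (ℕ → Bool) → Set
Vanishes T f = ∀ p → T ≤ p → f p ≡ false

wsum-vanishes : ∀ w {f T} k → Vanishes T f → wsum w f (k + T) ≡ wsum w f T
wsum-vanishes w zero off = refl
wsum-vanishes w {f} {T} (suc k) off
  rewrite off (k + T) (m≤n+m T k) = trans (+-identityʳ _) (wsum-vanishes w k off)

_[_≔_] : (ℕ → Bool) → ℕ → Bool → ℕ → Bool
(f [ x ≔ b ]) p with p ≟ x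
... | yes _ = b
... | no _ = f p

update-≡ : ∀ f x b → (f [ x ≔ b ]) x ≡ b
update-≡ f x b with x ≟ x
... | yes _ = refl
... | no x≢x = ⊥-elim (x≢x refl)

update-≢ : ∀ f {x} b {p} → p ≢ x → (f [ x ≔ b ]) p ≡ f p
update-≢ f {x} b {p} p≢x with p ≟ x
... | yes p≡x = ⊥-elim (p≢x p≡x)
... | no _ = refl

wsum-insert : ∀ w f {x} T → f x ≡ false → x < T → wsum w (f [ x ≔ true ]) T ≡ w x + wsum w f T
wsum-insert w f {x} (suc T) fx x<1+T with x ≟ T
... | yes refl
  rewrite update-≡ f x true | fx | wsum-cong w x (λ p p<x → update-≢ f true (<⇒≢ p<x))
  = trans (+-comm _ (w x)) (cong (_+_ (w x)) (sym (+-identityʳ _)))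
... | no x≢T = begin
  wsum w (f [ x ≔ true ]) T + (f [ x ≔ true ]) T · w T
    ≡⟨ cong₂ _+_ (wsum-insert w f T fx (≤∧≢⇒< (≤-pred x<1+T) x≢T))
                 (cong (_· w T) (update-≢ f true (≢-sym x≢T))) ⟩
  w x + wsum w f T + f T · w T
    ≡⟨ +-assoc (w x) _ _ ⟩
  w x + (wsum w f T + f T · w T) ∎
  where open ≡-Reasoning

-- Zeckendorf uniqueness

NoAdjacent : (ℕ → Bool) → Set
NoAdjacent f = ∀ p → f p ≡ true → f (suc p) ≡ false

NoAdjacentExcept : ℕ → (ℕ → Bool) → Set
NoAdjacentExcept q f = ∀ p → p ≢ q → f p ≡ true → f (suc p) ≡ false

ZeroBefore : ℕ → (ℕ → Bool) → Set
ZeroBefore q f = ∀ p → suc p ≡ q → f p ≡ false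

record Zeckendorf (f : ℕ → Bool) : Set where
  field
    noAdjacent : NoAdjacent f
    zero-0 : f 0 ≡ false
    zero-1 : f 1 ≡ false

wsum-fib-< : ∀ {f} → Zeckendorf f → ∀ T → wsum fib f (suc T) < fib (suc T)
wsum-fib-< {f} z T = proj₁ (both T)
  where
  open Zeckendorf z
  both : ∀ T → wsum fib f (1 + T) < fib (1 + T) × wsum fib f (2 + T) < fib (2 + T)
  both zero rewrite zero-0 | zero-1 = s≤s z≤n , s≤s z≤n
  both (suc T) = proj₂ (both T) , next (proj₁ (both T)) (proj₂ (both T))
    where
    next : wsum fib f (1 + T) < fib (1 + T) → wsum fib f (2 + T) < fib (2 + T) →
           wsum fib f (3 + T) < fib (3 + T)
    next h₁ h₂ with f (2 + T) in e₂
    ... | false = <-≤-trans (subst (_< fib (2 + T)) (sym (+-identityʳ _)) h₂) (m≤m+n _ _)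
    ... | true with f (1 + T) in e₁
    ...   | true = ⊥-elim (true≢false (trans (sym e₂) (noAdjacent (1 + T) e₁)))
    ...   | false = subst₂ _<_ (cong (_+ fib (2 + T)) (sym (+-identityʳ (wsum fib f (1 + T))))) (+-comm (fib (1 + T)) _)
                           (+-monoˡ-< (fib (2 + T)) h₁)

zeckendorf-top-≢ : ∀ {f g} → Zeckendorf f → Zeckendorf g → ∀ T → f T ≡ true →
                   wsum fib f T + fib T ≢ wsum fib g T + 0
zeckendorf-top-≢ zf zg zero fT _ with trans (sym fT) (Zeckendorf.zero-0 zf)
... | ()
zeckendorf-top-≢ {f} {g} zf zg (suc T) _ eq = <-irrefl refl (begin-strict
  fib (suc T)                         ≤⟨ m≤n+m _ _ ⟩
  wsum fib f (suc T) + fib (suc T)    ≡⟨ eq ⟩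
  wsum fib g (suc T) + 0              ≡⟨ +-identityʳ _ ⟩
  wsum fib g (suc T)                  <⟨ wsum-fib-< zg T ⟩
  fib (suc T)                         ∎)
  where open ≤-Reasoning

top-digits-agree : ∀ {f g} → Zeckendorf f → Zeckendorf g →
                   ∀ T → wsum fib f (suc T) ≡ wsum fib g (suc T) → f T ≡ g T
top-digits-agree {f} {g} zf zg T eq with f T in fT | g T in gT
... | true | true = refl
... | false | false = refl
... | true | false = ⊥-elim (zeckendorf-top-≢ zf zg T fT eq)
... | false | true = ⊥-elim (zeckendorf-top-≢ zg zf T gT (sym eq))

zeckendorf-unique : ∀ {f g} → Zeckendorf f → Zeckendorf g →
                    ∀ T → wsum fib f T ≡ wsum fib g T → ∀ p → p < T → f p ≡ g p
zeckendorf-unique {f} {g} zf zg (suc T) eq p p<1+T with p ≟ T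
... | yes refl = top-digits-agree zf zg T eq
... | no p≢T = zeckendorf-unique zf zg T (+-cancelʳ-≡ _ _ _ eq′) p (≤∧≢⇒< (≤-pred p<1+T) p≢T)
  where
  eq′ : wsum fib f T + f T · fib T ≡ wsum fib g T + f T · fib T
  eq′ = trans eq (cong (λ b → wsum fib g T + b · fib T) (sym (top-digits-agree zf zg T eq)))

zeckendorf-unique′ : ∀ {f g T U} → Zeckendorf f → Zeckendorf g → Vanishes T f → Vanishes U g →
                     wsum fib f T ≡ wsum fib g U → ∀ p → f p ≡ g p
zeckendorf-unique′ {f} {g} {T} {U} zf zg f-off g-off eq p with p <? U + T
... | yes p< = zeckendorf-unique zf zg (U + T) eq′ p p<
  where
  eq′ : wsum fib f (U + T) ≡ wsum fib g (U + T)
  eq′ = trans (wsum-vanishes fib U f-off)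
        (trans eq (trans (sym (wsum-vanishes fib T g-off)) (cong (wsum fib g) (+-comm T U))))
... | no p≮ = trans (f-off p (≤-trans (m≤n+m T U) (≮⇒≥ p≮))) (sym (g-off p (≤-trans (m≤m+n U T) (≮⇒≥ p≮))))

-- Carrying

write3 : (ℕ → Bool) → ℕ → Bool → Bool → Bool → ℕ → Bool
write3 f q a b c = ((f [ q ≔ a ]) [ 1 + q ≔ b ]) [ 2 + q ≔ c ]

module _ (f : ℕ → Bool) (q : ℕ) (a b c : Bool) where
  private
    f₁ f₂ : ℕ → Bool
    f₁ = f [ q ≔ a ]
    f₂ = f₁ [ 1 + q ≔ b ]

  write3-0 : write3 f q a b c q ≡ a
  write3-0 = trans (update-≢ f₂ {2 + q} c {q} n≢2+n) (trans (update-≢ f₁ {1 + q} b {q} n≢1+n) (update-≡ f q a))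

  write3-1 : write3 f q a b c (1 + q) ≡ b
  write3-1 = trans (update-≢ f₂ {2 + q} c {1 + q} n≢1+n) (update-≡ f₁ (1 + q) b)

  write3-2 : write3 f q a b c (2 + q) ≡ c
  write3-2 = update-≡ f₂ (2 + q) c

  write3-other : ∀ {p} → p ≢ q → p ≢ 1 + q → p ≢ 2 + q → write3 f q a b c p ≡ f p
  write3-other p≢q p≢1+q p≢2+q =
    trans (update-≢ f₂ c p≢2+q) (trans (update-≢ f₁ b p≢1+q) (update-≢ f a p≢q))

-- One carry φ^q + φ^(q+1) = φ^(q+2) turns f into g.
record Carry (q : ℕ) (f g : ℕ → Bool) : Set where
  field
    f-digits : f q ≡ true × f (1 + q) ≡ true × f (2 + q) ≡ false
    g-digits : g q ≡ false × g (1 + q) ≡ false × g (2 + q) ≡ true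
    elsewhere : ∀ {p} → p ≢ q → p ≢ 1 + q → p ≢ 2 + q → f p ≡ g p

carry-write3 : ∀ {f q} → f q ≡ true → f (1 + q) ≡ true → f (2 + q) ≡ false →
               Carry q f (write3 f q false false true)
carry-write3 {f} {q} f0 f1 f2 = record
  { f-digits = f0 , f1 , f2
  ; g-digits = write3-0 f q false false true , write3-1 f q false false true , write3-2 f q false false true
  ; elsewhere = λ p≢q p≢1+q p≢2+q → sym (write3-other f q false false true p≢q p≢1+q p≢2+q)
  }

uncarry-write3 : ∀ {g q} → g q ≡ false → g (1 + q) ≡ false → g (2 + q) ≡ true →
                 Carry q (write3 g q true true false) g
uncarry-write3 {g} {q} g0 g1 g2 = record
  { f-digits = write3-0 g q true true false , write3-1 g q true true false , write3-2 g q true true false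
  ; g-digits = g0 , g1 , g2
  ; elsewhere = write3-other g q true true false
  }

module _ {q : ℕ} {f g : ℕ → Bool} (c : Carry q f g) where
  open Carry c

  carry-below : ∀ {p} → p < q → f p ≡ g p
  carry-below p<q = elsewhere (<⇒≢ p<q) (<⇒≢ (m<n⇒m<1+n p<q)) (<⇒≢ (m<n⇒m<1+n (m<n⇒m<1+n p<q)))

  carry-above : ∀ {p} → 2 + q < p → f p ≡ g p
  carry-above 2+q<p = elsewhere (>⇒≢ (<-trans (n<1+n q) 1+q<p)) (>⇒≢ 1+q<p) (>⇒≢ 2+q<p)
    where
    1+q<p = <-trans (n<1+n (1 + q)) 2+q<p

  wsum-Carry : ∀ {w} → FibLike w → ∀ T → 2 + q < T → wsum w f T ≡ wsum w g T
  wsum-Carry {w} fl T 2+q<T = begin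
    wsum w f T                         ≡⟨ cong (wsum w f) T≡ ⟩
    wsum w f (T ∸ (3 + q) + (3 + q))   ≡⟨ above (T ∸ (3 + q)) ⟩
    wsum w g (T ∸ (3 + q) + (3 + q))   ≡⟨ cong (wsum w g) (sym T≡) ⟩
    wsum w g T                         ∎
    where
    open ≡-Reasoning
    T≡ : T ≡ T ∸ (3 + q) + (3 + q)
    T≡ = sym (m∸n+n≡m 2+q<T)
    below : wsum w f q ≡ wsum w g q
    below = wsum-cong w q (λ p → carry-below)
    base : wsum w f (3 + q) ≡ wsum w g (3 + q)
    base rewrite proj₁ f-digits | proj₁ (proj₂ f-digits) | proj₂ (proj₂ f-digits)
               | proj₁ g-digits | proj₁ (proj₂ g-digits) | proj₂ (proj₂ g-digits)
               | below | fl q = arith (wsum w g q) (w q) (w (1 + q))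
      where
      arith : ∀ a x y → a + x + y + 0 ≡ a + 0 + 0 + (y + x)
      arith = solve-∀
    above : ∀ k → wsum w f (k + (3 + q)) ≡ wsum w g (k + (3 + q))
    above zero = base
    above (suc k) = cong₂ _+_ (above k) (cong (_· w (k + (3 + q))) (carry-above (m≤n+m (3 + q) k)))

  noAdjacentExcept-carry : NoAdjacentExcept q f → NoAdjacentExcept (2 + q) g
  noAdjacentExcept-carry na p p≢2+q gp with p ≟ q | p ≟ 1 + q | suc p ≟ q
  ... | yes refl | _ | _ = ⊥-elim (true≢false (trans (sym gp) (proj₁ g-digits)))
  ... | no _ | yes refl | _ = ⊥-elim (true≢false (trans (sym gp) (proj₁ (proj₂ g-digits))))
  ... | no _ | no _ | yes refl = proj₁ g-digits
  ... | no p≢q | no p≢1+q | no 1+p≢q =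
    trans (sym (elsewhere 1+p≢q (p≢q ∘ suc-injective) (p≢1+q ∘ suc-injective)))
          (na p p≢q (trans (elsewhere p≢q p≢1+q p≢2+q) gp))

  noAdjacentExcept-uncarry : NoAdjacentExcept (2 + q) g → ZeroBefore q g → NoAdjacentExcept q f
  noAdjacentExcept-uncarry na zb p p≢q fp with p ≟ 1 + q | p ≟ 2 + q | suc p ≟ q
  ... | yes refl | _ | _ = proj₂ (proj₂ f-digits)
  ... | no _ | yes refl | _ = ⊥-elim (true≢false (trans (sym fp) (proj₂ (proj₂ f-digits))))
  ... | no p≢1+q | no p≢2+q | yes 1+p≡q =
    ⊥-elim (true≢false (trans (sym fp) (trans (elsewhere p≢q p≢1+q p≢2+q) (zb p 1+p≡q))))
  ... | no p≢1+q | no p≢2+q | no 1+p≢q =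
    trans (elsewhere 1+p≢q (p≢q ∘ suc-injective) (p≢1+q ∘ suc-injective))
          (na p p≢2+q (trans (sym (elsewhere p≢q p≢1+q p≢2+q)) fp))

noAdjacentExcept⇒noAdjacent : ∀ {q f} → NoAdjacentExcept q f → f (1 + q) ≡ false → NoAdjacent f
noAdjacentExcept⇒noAdjacent {q} na f1+q p fp with p ≟ q
... | yes refl = f1+q
... | no p≢q = na p p≢q fp

true⇒< : ∀ {T f p} → Vanishes T f → f p ≡ true → p < T
true⇒< {T} {p = p} off fp with p <? T
... | yes p<T = p<T
... | no p≮T = ⊥-elim (true≢false (trans (sym fp) (off p (≮⇒≥ p≮T))))

data ZeroPairsThenOne (f : ℕ → Bool) : ℕ → Set where
  here : ∀ {q} → f q ≡ true → ZeroPairsThenOne f q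
  skip : ∀ {q} → f q ≡ false → f (1 + q) ≡ false → ZeroPairsThenOne f (2 + q) → ZeroPairsThenOne f q

zeroPairsThenOne-< : ∀ {T f q} → Vanishes T f → ZeroPairsThenOne f q → q < T
zeroPairsThenOne-< off (here fq) = true⇒< off fq
zeroPairsThenOne-< off (skip _ _ rest) = <-trans (m<n+m _ (s≤s z≤n)) (zeroPairsThenOne-< off rest)

zeroPairsThenOne-transport : ∀ {f g q r} → (∀ j → f (j + q) ≡ g (j + r)) →
                             ZeroPairsThenOne f q → ZeroPairsThenOne g r
zeroPairsThenOne-transport f≗g (here fq) = here (trans (sym (f≗g 0)) fq)
zeroPairsThenOne-transport {f} {g} {q} {r} f≗g (skip fq f1q rest) =
  skip (trans (sym (f≗g 0)) fq) (trans (sym (f≗g 1)) f1q) (zeroPairsThenOne-transport f≗g′ rest)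
  where
  f≗g′ : ∀ j → f (j + (2 + q)) ≡ g (j + (2 + r))
  f≗g′ j = subst₂ (λ a b → f a ≡ g b) (sym (m+2+n≡2+m+n j q)) (sym (m+2+n≡2+m+n j r)) (f≗g (2 + j))

zeroPairsThenOne? : ∀ {T f} → Vanishes T f → ∀ q → Dec (ZeroPairsThenOne f q)
zeroPairsThenOne? {T} {f} off q = go T q (m≤m+n T q)
  where
  tail : ∀ {q} → f q ≡ false → ZeroPairsThenOne f q → f (1 + q) ≡ false × ZeroPairsThenOne f (2 + q)
  tail fq (here fq′) = ⊥-elim (true≢false (trans (sym fq′) fq))
  tail _ (skip _ f1q rest) = f1q , rest
  go : ∀ k q → T ≤ k + q → Dec (ZeroPairsThenOne f q)
  go k q T≤ with f q in fq
  ... | true = yes (here fq)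
  ... | false = map′ (λ (f1q , rest) → skip fq f1q rest) (tail fq) (f (1 + q) ≟ᵇ false ×-dec beyond k T≤)
    where
    beyond : ∀ k → T ≤ k + q → Dec (ZeroPairsThenOne f (2 + q))
    beyond (suc (suc k)) T≤ = go k (2 + q) (subst (T ≤_) (sym (m+2+n≡2+m+n k q)) T≤)
    beyond zero T≤ = no λ rest →
      <⇒≱ (zeroPairsThenOne-< off rest) (≤-trans T≤ (≤-trans (n≤1+n q) (n≤1+n (1 + q))))
    beyond (suc zero) T≤ = no λ rest → <⇒≱ (zeroPairsThenOne-< off rest) (≤-trans T≤ (n≤1+n (1 + q)))

record Carried (q T : ℕ) (h : ℕ → Bool) : Set where
  field
    result : ℕ → Bool
    agree-below : ∀ p → p < q → result p ≡ h p
    noAdjacent : NoAdjacent result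
    zero-q : result q ≡ false
    zero-1+q : result (1 + q) ≡ false
    then-one : ZeroPairsThenOne result (2 + q)
    vanishes : Vanishes (suc T) result
    same-wsum : ∀ {w} → FibLike w → wsum w result (suc T) ≡ wsum w h (suc T)

module _ {q T : ℕ} {h g : ℕ → Bool} (c : Carry q h g) (off : Vanishes T h) where
  open Carry c
  private
    2+q<1+T : 2 + q < suc T
    2+q<1+T = s≤s (true⇒< off (proj₁ (proj₂ f-digits)))

  carried-once : NoAdjacent g → Carried q T h
  carried-once na = record
    { result = g
    ; agree-below = λ p p<q → sym (carry-below c p<q)
    ; noAdjacent = na
    ; zero-q = proj₁ g-digits
    ; zero-1+q = proj₁ (proj₂ g-digits)
    ; then-one = here (proj₂ (proj₂ g-digits))
    ; vanishes = λ p 1+T≤p →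
        trans (sym (carry-above c (<-≤-trans 2+q<1+T 1+T≤p))) (off p (≤-trans (n≤1+n T) 1+T≤p))
    ; same-wsum = λ fl → sym (wsum-Carry c fl (suc T) 2+q<1+T)
    }

  carried-further : Carried (2 + q) T g → Carried q T h
  carried-further R = record
    { result = result
    ; agree-below = λ p p<q → trans (agree-below p (<-trans p<q q<2+q)) (sym (carry-below c p<q))
    ; noAdjacent = noAdjacent
    ; zero-q = trans (agree-below q q<2+q) (proj₁ g-digits)
    ; zero-1+q = trans (agree-below (1 + q) (n<1+n (1 + q))) (proj₁ (proj₂ g-digits))
    ; then-one = skip zero-q zero-1+q then-one
    ; vanishes = vanishes
    ; same-wsum = λ fl → trans (same-wsum fl) (sym (wsum-Carry c fl (suc T) 2+q<1+T))
    }
    where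
    open Carried R
    q<2+q : q < 2 + q
    q<2+q = m<n+m q (s≤s z≤n)

carry : ∀ k q {T h} → T ≤ k + q → Vanishes T h → NoAdjacentExcept q h →
        h q ≡ true → h (1 + q) ≡ true → Carried q T h
carry zero q T≤ off na hq h1q = ⊥-elim (<⇒≱ (<-trans (n<1+n q) (true⇒< off h1q)) T≤)
carry (suc zero) q T≤ off na hq h1q = ⊥-elim (<⇒≱ (true⇒< off h1q) T≤)
carry (suc (suc k)) q {T} {h} T≤ off na hq h1q with h (3 + q) in h3q
... | false = carried-once c off
  (noAdjacentExcept⇒noAdjacent (noAdjacentExcept-carry c na) (trans (sym (carry-above c (n<1+n (2 + q)))) h3q))
  where
  c = carry-write3 hq h1q (na (1 + q) 1+n≢n h1q)
... | true = carried-further c off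
  (carry k (2 + q) T≤′ off₁ (noAdjacentExcept-carry c na)
         (proj₂ (proj₂ (Carry.g-digits c))) (trans (sym (carry-above c (n<1+n (2 + q)))) h3q))
  where
  c = carry-write3 hq h1q (na (1 + q) 1+n≢n h1q)
  2+q<T : 2 + q < T
  2+q<T = <-trans (n<1+n (2 + q)) (true⇒< off h3q)
  T≤′ : T ≤ k + (2 + q)
  T≤′ = subst (T ≤_) (sym (m+2+n≡2+m+n k q)) T≤
  off₁ : Vanishes T (write3 h q false false true)
  off₁ p T≤p = trans (sym (carry-above c (<-≤-trans 2+q<T T≤p))) (off p T≤p)

record Uncarried (q T : ℕ) (h : ℕ → Bool) : Set where
  field
    result : ℕ → Bool
    one-q : result q ≡ true
    one-1+q : result (1 + q) ≡ true
    agree-below : ∀ p → p < q → result p ≡ h p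
    noAdjacentExcept : NoAdjacentExcept q result
    vanishes : Vanishes T result
    same-wsum : ∀ {w} → FibLike w → wsum w result T ≡ wsum w h T

uncarry : ∀ {q T h} → Vanishes T h → NoAdjacent h → ZeroBefore q h →
          h q ≡ false → h (1 + q) ≡ false → ZeroPairsThenOne h (2 + q) → Uncarried q T h
uncarry {q} {T} {h} off na zb hq h1q (here h2q) = record
  { result = write3 h q true true false
  ; one-q = proj₁ f-digits
  ; one-1+q = proj₁ (proj₂ f-digits)
  ; agree-below = λ p → carry-below c
  ; noAdjacentExcept = noAdjacentExcept-uncarry c (λ p _ → na p) zb
  ; vanishes = λ p T≤p → trans (carry-above c (<-≤-trans 2+q<T T≤p)) (off p T≤p)
  ; same-wsum = λ fl → wsum-Carry c fl T 2+q<T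
  }
  where
  c = uncarry-write3 hq h1q h2q
  open Carry c
  2+q<T = true⇒< off h2q
uncarry {q} {T} {h} off na zb hq h1q (skip h2q h3q rest) = record
  { result = write3 result q true true false
  ; one-q = proj₁ f-digits
  ; one-1+q = proj₁ (proj₂ f-digits)
  ; agree-below = λ p p<q → trans (carry-below c p<q) (agree-below p (<-trans p<q q<2+q))
  ; noAdjacentExcept = noAdjacentExcept-uncarry c noAdjacentExcept
      (λ p 1+p≡q → trans (agree-below p (<-trans (≤-reflexive 1+p≡q) q<2+q)) (zb p 1+p≡q))
  ; vanishes = λ p T≤p → trans (carry-above c (<-≤-trans 2+q<T T≤p)) (vanishes p T≤p)
  ; same-wsum = λ fl → trans (wsum-Carry c fl T 2+q<T) (same-wsum fl)
  }
  where
  q<2+q : q < 2 + q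
  q<2+q = m<n+m q (s≤s z≤n)
  open Uncarried (uncarry off na (λ p 1+p≡2+q → subst (λ x → h x ≡ false) (sym (suc-injective 1+p≡2+q)) h1q)
                          h2q h3q rest)
  c = uncarry-write3 (trans (agree-below q q<2+q) hq) (trans (agree-below (1 + q) (n<1+n (1 + q))) h1q) one-q
  open Carry c using (f-digits)
  2+q<T : 2 + q < T
  2+q<T = <-trans (m<n+m (2 + q) {2} (s≤s z≤n)) (zeroPairsThenOne-< off rest)

-- The digits of β(N) around φ⁰ when N has a special representation, φ⁰ at q:
-- … 0 | 0 0 … 0 0 1 with the bar just before q.
CarryShape : (ℕ → Bool) → ℕ → Set
CarryShape f q = ZeroBefore q f × f q ≡ false × f (1 + q) ≡ false × ZeroPairsThenOne f (2 + q)

carryShape? : ∀ {T f} → Vanishes T f → ∀ V → Dec (CarryShape f (suc V))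
carryShape? {f = f} off V =
  map′ (λ (fV , rest) → (λ { p refl → fV }) , rest) (λ (zb , rest) → zb V refl , rest)
       (f V ≟ᵇ false ×-dec f (1 + V) ≟ᵇ false ×-dec f (2 + V) ≟ᵇ false ×-dec zeroPairsThenOne? off (3 + V))

extend : (ℕ → Bool) → ℤ → Bool
extend f (+ p) = f p
extend f -[1+ _ ] = false

extend-cong : ∀ {f g} → (∀ p → f p ≡ g p) → ∀ z → extend f z ≡ extend g z
extend-cong f≗g (+ p) = f≗g p
extend-cong f≗g -[1+ _ ] = refl

extend-below : ∀ {f g W} → (∀ p → p < W → f p ≡ g p) → ∀ k →
               extend f (-[1+ k ] ℤ.+ + W) ≡ extend g (-[1+ k ] ℤ.+ + W)
extend-below {f} {g} {W} f≗g k = go (-[1+ k ] ℤ.+ + W) refl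
  where
  go : ∀ z → -[1+ k ] ℤ.+ + W ≡ z → extend f z ≡ extend g z
  go -[1+ _ ] _ = refl
  go (+ p) e = f≗g p (≤-trans (m<m+n p {suc k} (s≤s z≤n)) (≤-reflexive (sym W≡)))
    where
    W≡ : W ≡ p + suc k
    W≡ = ℤP.+-injective (trans (ring -[1+ k ] (+ W)) (cong (ℤ._- -[1+ k ]) e))
      where
      ring : ∀ a w → w ≡ (a ℤ.+ w) - a
      ring = solve-∀ℤ

carryShape-transport : ∀ {f g V W} → (∀ i → extend f (i ℤ.+ + suc V) ≡ extend g (i ℤ.+ + suc W)) →
                       CarryShape f (suc V) → CarryShape g (suc W)
carryShape-transport {f} {g} {V} {W} f≗g (zb , f0 , f1 , rest) =
  (λ { p refl → trans (sym (f≗g -[1+ 0 ])) (zb V refl) }) ,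
  trans (sym (f≗g (+ 0))) f0 ,
  trans (sym (f≗g (+ 1))) f1 ,
  zeroPairsThenOne-transport f≗g′ rest
  where
  f≗g′ : ∀ j → f (j + (2 + suc V)) ≡ g (j + (2 + suc W))
  f≗g′ j = subst₂ (λ a b → f a ≡ g b) (sym (m+2+n≡2+m+n j (suc V))) (sym (m+2+n≡2+m+n j (suc W)))
                  (f≗g (+ (2 + j)))

module Shifted {d : ℤ → Bool} {f : ℕ → Bool} {W : ℕ} (d≡ : ∀ i → d i ≡ extend f (i ℤ.+ + W)) where

  private
    at : ∀ p → d (+ p - + W) ≡ f p
    at p = trans (d≡ _) (cong (extend f) (ring (+ p) (+ W)))
      where
      ring : ∀ p w → (p - w) ℤ.+ w ≡ p
      ring = solve-∀ℤ

    at-suc : ∀ p → d ((+ p - + W) ℤ.+ + 1) ≡ f (suc p)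
    at-suc p = trans (d≡ _) (cong (extend f) (ring (+ p) (+ W)))
      where
      ring : ∀ p w → ((p - w) ℤ.+ + 1) ℤ.+ w ≡ + 1 ℤ.+ p
      ring = solve-∀ℤ

    adjacent : ∀ i → d i ≡ true → d (i ℤ.+ + 1) ≡ true →
               Σ ℕ λ p → i ≡ + p - + W × f p ≡ true × f (suc p) ≡ true
    adjacent i di di+1 = go (i ℤ.+ + W) refl
      where
      go : ∀ z → i ℤ.+ + W ≡ z → Σ ℕ λ p → i ≡ + p - + W × f p ≡ true × f (suc p) ≡ true
      go -[1+ _ ] e = ⊥-elim (true≢false (trans (sym di) (trans (d≡ i) (cong (extend f) e))))
      go (+ p) e =
        p ,
        trans (ring₁ i (+ W)) (cong (ℤ._- + W) e) ,
        trans (cong (extend f) (sym e)) (trans (sym (d≡ i)) di) ,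
        trans (cong (extend f) (sym (trans (ring₂ i (+ W)) (cong (ℤ._+_ (+ 1)) e)))) (trans (sym (d≡ _)) di+1)
        where
        ring₁ : ∀ i w → i ≡ (i ℤ.+ w) - w
        ring₁ = solve-∀ℤ
        ring₂ : ∀ i w → (i ℤ.+ + 1) ℤ.+ w ≡ + 1 ℤ.+ (i ℤ.+ w)
        ring₂ = solve-∀ℤ

  noAdjacent⇐ : (∀ i → ¬ (d i ≡ true × d (i ℤ.+ + 1) ≡ true)) → NoAdjacent f
  noAdjacent⇐ nb p fp with f (suc p) in f1p
  ... | false = refl
  ... | true = ⊥-elim (nb (+ p - + W) (trans (at p) fp , trans (at-suc p) f1p))

  noAdjacent⇒ : NoAdjacent f → ∀ i → ¬ (d i ≡ true × d (i ℤ.+ + 1) ≡ true)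
  noAdjacent⇒ na i (di , di+1) with adjacent i di di+1
  ... | p , _ , fp , f1p = true≢false (trans (sym f1p) (na p fp))

  noAdjacentExcept⇐ : (∀ i → i ≢ + 0 → ¬ (d i ≡ true × d (i ℤ.+ + 1) ≡ true)) → NoAdjacentExcept W f
  noAdjacentExcept⇐ nb p p≢W fp with f (suc p) in f1p
  ... | false = refl
  ... | true = ⊥-elim (nb (+ p - + W) i≢0 (trans (at p) fp , trans (at-suc p) f1p))
    where
    i≢0 : + p - + W ≢ + 0
    i≢0 e = p≢W (ℤP.+-injective (trans (ring (+ p) (+ W)) (cong (ℤ._+ + W) e)))
      where
      ring : ∀ p w → p ≡ (p - w) ℤ.+ w
      ring = solve-∀ℤ

  noAdjacentExcept⇒ : NoAdjacentExcept W f → ∀ i → i ≢ + 0 → ¬ (d i ≡ true × d (i ℤ.+ + 1) ≡ true)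
  noAdjacentExcept⇒ na i i≢0 (di , di+1) with adjacent i di di+1
  ... | p , i≡ , fp , f1p = true≢false (trans (sym f1p) (na p p≢W fp))
    where
    p≢W : p ≢ W
    p≢W refl = i≢0 (trans i≡ (ℤP.+-inverseʳ (+ W)))

bitℤ-+ : ∀ b x → bitℤ b ℤ.+ + x ≡ + (b · 1 + x)
bitℤ-+ true x = refl
bitℤ-+ false x = refl

horner-applyUpTo : ∀ f T → horner (applyUpTo f T) ≡ (+ wsum fibPrev f T , + wsum fib f T)
horner-applyUpTo f zero = refl
horner-applyUpTo f (suc T) rewrite horner-applyUpTo (f ∘ suc) T = cong₂ _,_
  (trans (bitℤ-+ (f 0) _) (cong +_ (sym (wsum-suc fibPrev f T))))
  (cong +_ (sym (begin
    wsum fib f (suc T)                            ≡⟨ wsum-suc fib f T ⟩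
    f 0 · 0 + wsum (fib ∘ suc) (f ∘ suc) T        ≡⟨ cong₂ _+_ (·-zeroʳ (f 0)) (wsum-congʷ (f ∘ suc) T fib-suc) ⟩
    wsum (λ p → fibPrev p + fib p) (f ∘ suc) T    ≡⟨ wsum-+ʷ fibPrev fib (f ∘ suc) T ⟩
    wsum fibPrev (f ∘ suc) T + wsum fib (f ∘ suc) T ∎)))
  where open ≡-Reasoning

horner-pad : ∀ s ds → horner (replicate s false ++ ds) ≡ iter s mulφ (horner ds)
horner-pad zero ds = refl
horner-pad (suc s) ds rewrite horner-pad s ds = cong₂ _,_ (ℤP.+-identityˡ _) (ℤP.+-identityˡ _)

iter-mulφ : ∀ N W → iter W mulφ (+ N , + 0) ≡ (+ (N * fibPrev W) , + (N * fib W))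
iter-mulφ N zero = cong₂ (λ a b → (+ a , + b)) (sym (*-identityʳ N)) (sym (*-zeroʳ N))
iter-mulφ N (suc W) rewrite iter-mulφ N W = cong (λ x → (+ (N * fib W) , + x))
  (sym (trans (cong (N *_) (fib-suc W)) (*-distribˡ-+ N (fibPrev W) (fib W))))

iter-suc : ∀ n (f : ℤφ → ℤφ) x → iter (suc n) f x ≡ iter n f (f x)
iter-suc zero f x = refl
iter-suc (suc n) f x = cong f (iter-suc n f x)

iter-+ : ∀ m n (f : ℤφ → ℤφ) x → iter (m + n) f x ≡ iter m f (iter n f x)
iter-+ zero n f x = refl
iter-+ (suc m) n f x = cong f (iter-+ m n f x)

iter-inverse : ∀ {f g : ℤφ → ℤφ} → (∀ x → f (g x) ≡ x) → ∀ n x → iter n f (iter n g x) ≡ x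
iter-inverse inv zero x = refl
iter-inverse {f} inv (suc n) x = trans (iter-suc n f _) (trans (cong (iter n f) (inv _)) (iter-inverse inv n x))

divφ-mulφ : ∀ x → divφ (mulφ x) ≡ x
divφ-mulφ (a , b) = cong (_, b) (ring a b)
  where
  ring : ∀ a b → (a ℤ.+ b) - b ≡ a
  ring = solve-∀ℤ

mulφ-divφ : ∀ x → mulφ (divφ x) ≡ x
mulφ-divφ (a , b) = cong (a ,_) (ring a b)
  where
  ring : ∀ a b → (b - a) ℤ.+ a ≡ b
  ring = solve-∀ℤ

scaleφ-iter : ∀ W x → scaleφ (ℤ.- + W) (iter W mulφ x) ≡ x
scaleφ-iter zero x = refl
scaleφ-iter (suc W) x = iter-inverse {divφ} {mulφ} divφ-mulφ (suc W) x

iter-scaleφ : ∀ lo W s → lo ℤ.+ + W ≡ + s → ∀ x → iter W mulφ (scaleφ lo x) ≡ iter s mulφ x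
iter-scaleφ (+ k) W s e x =
  trans (sym (iter-+ W k mulφ x)) (cong (λ n → iter n mulφ x) (ℤP.+-injective (trans (cong +_ (+-comm W k)) e)))
iter-scaleφ -[1+ k ] W s e x = begin
  iter W mulφ (iter (suc k) divφ x)                       ≡⟨ cong (λ n → iter n mulφ _) W≡ ⟩
  iter (s + suc k) mulφ (iter (suc k) divφ x)             ≡⟨ iter-+ s (suc k) mulφ _ ⟩
  iter s mulφ (iter (suc k) mulφ (iter (suc k) divφ x))   ≡⟨ cong (iter s mulφ) (iter-inverse {mulφ} {divφ} mulφ-divφ (suc k) x) ⟩
  iter s mulφ x                                           ∎
  where
  open ≡-Reasoning
  ring : ∀ a w → w ≡ (a ℤ.+ w) - a
  ring = solve-∀ℤ
  W≡ : W ≡ s + suc k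
  W≡ = ℤP.+-injective (trans (ring -[1+ k ] (+ W)) (cong (ℤ._- -[1+ k ]) e))

digit-rep : ∀ lo ds i → digit (rep lo ds) i ≡ extend (nth ds) (i - lo)
digit-rep lo ds i with i - lo
... | + k = refl
... | -[1+ k ] = refl

nth-applyUpTo : ∀ {T f} → Vanishes T f → ∀ p → nth (applyUpTo f T) p ≡ f p
nth-applyUpTo {zero} off p = sym (off p z≤n)
nth-applyUpTo {suc T} off zero = refl
nth-applyUpTo {suc T} off (suc p) = nth-applyUpTo {T} (λ p T≤p → off (suc p) (s≤s T≤p)) p

applyUpTo-nth : ∀ ds → applyUpTo (nth ds) (length ds) ≡ ds
applyUpTo-nth [] = refl
applyUpTo-nth (d ∷ ds) = cong (d ∷_) (applyUpTo-nth ds)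

nth-vanishes : ∀ ds → Vanishes (length ds) (nth ds)
nth-vanishes [] p _ = refl
nth-vanishes (d ∷ ds) (suc p) (s≤s le) = nth-vanishes ds p le

extend-pad : ∀ s ds z → extend (nth ds) (z - + s) ≡ extend (nth (replicate s false ++ ds)) z
extend-pad zero ds z = cong (extend (nth ds)) (ℤP.+-identityʳ z)
extend-pad (suc s) ds (+ zero) = refl
extend-pad (suc s) ds (+ suc p) = trans (cong (extend (nth ds)) (ring (+ p) (+ s))) (extend-pad s ds (+ p))
  where
  ring : ∀ p s → (+ 1 ℤ.+ p) - (+ 1 ℤ.+ s) ≡ p - s
  ring = solve-∀ℤ
extend-pad (suc s) ds -[1+ k ] = refl

-- f is a φ-expansion of N once position W is read as φ⁰, seen through the
-- two coordinates of φ^p = fibPrev p + fib p · φ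
Expands : ℕ → ℕ → ℕ → (ℕ → Bool) → Set
Expands N W T f = wsum fibPrev f T ≡ N * fibPrev W × wsum fib f T ≡ N * fib W

toRep : ℕ → ℕ → (ℕ → Bool) → Rep
toRep W T f = rep (ℤ.- + W) (applyUpTo f T)

represents-toRep : ∀ {N W T f} → Expands N W T f → Represents N (toRep W T f)
represents-toRep {N} {W} {T} {f} (e₁ , e₂) = begin
  scaleφ (ℤ.- + W) (horner (applyUpTo f T))
    ≡⟨ cong (scaleφ (ℤ.- + W)) (trans (horner-applyUpTo f T) (cong₂ (λ a b → (+ a , + b)) e₁ e₂)) ⟩
  scaleφ (ℤ.- + W) (+ (N * fibPrev W) , + (N * fib W))
    ≡⟨ cong (scaleφ (ℤ.- + W)) (sym (iter-mulφ N W)) ⟩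
  scaleφ (ℤ.- + W) (iter W mulφ (+ N , + 0))
    ≡⟨ scaleφ-iter W _ ⟩
  (+ N , + 0) ∎
  where open ≡-Reasoning

digit-toRep : ∀ {W T f} → Vanishes T f → ∀ i → digit (toRep W T f) i ≡ extend f (i ℤ.+ + W)
digit-toRep {W} {T} {f} off i = begin
  digit (toRep W T f) i                          ≡⟨ digit-rep _ _ i ⟩
  extend (nth (applyUpTo f T)) (i - ℤ.- + W)   ≡⟨ cong (λ z → extend _ (i ℤ.+ z)) (ℤP.neg-involutive (+ W)) ⟩
  extend (nth (applyUpTo f T)) (i ℤ.+ + W)       ≡⟨ extend-cong (nth-applyUpTo off) (i ℤ.+ + W) ⟩
  extend f (i ℤ.+ + W)                           ∎
  where open ≡-Reasoning

bergman-toRep : ∀ {N W T f} → Vanishes T f → NoAdjacent f → Expands N W T f → IsBergman N (toRep W T f)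
bergman-toRep {N} {W} {T} {f} off na ex =
  represents-toRep {N} {W} {T} {f} ex , Shifted.noAdjacent⇒ (digit-toRep {W} {T} {f} off) na

special-toRep : ∀ {N W T f} → Vanishes T f → NoAdjacentExcept W f → f W ≡ true → f (1 + W) ≡ true →
                Expands N W T f → IsSpecial N (toRep W T f)
special-toRep {N} {W} {T} {f} off na fW f1W ex =
  represents-toRep {N} {W} {T} {f} ex , trans (digit≡ (+ 1)) f1W , trans (digit≡ (+ 0)) fW ,
  Shifted.noAdjacentExcept⇒ digit≡ na
  where
  digit≡ = digit-toRep {W} {T} {f} off

-- r shifted up by W, with W large enough that positions 0 and 1, where the
-- Fibonacci weights degenerate, stay empty
record Normalized (r : Rep) (W : ℕ) : Set where
  field
    f : ℕ → Bool
    T : ℕ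
    vanishes : Vanishes T f
    zero-0 : f 0 ≡ false
    zero-1 : f 1 ≡ false
    digit≡ : ∀ i → digit r i ≡ extend f (i ℤ.+ + W)
    expands : ∀ {N} → Represents N r → Expands N W T f

normalized : ∀ lo ds W s → 2 ≤ s → lo ℤ.+ + W ≡ + s → Normalized (rep lo ds) W
normalized lo ds W (suc (suc s′)) _ e = record
  { f = nth padded
  ; T = length padded
  ; vanishes = nth-vanishes padded
  ; zero-0 = refl
  ; zero-1 = refl
  ; digit≡ = λ i → trans (digit-rep lo ds i) (trans (cong (extend (nth ds)) (shift i)) (extend-pad s ds (i ℤ.+ + W)))
  ; expands = λ rp → ℤP.+-injective (cong proj₁ (values rp)) , ℤP.+-injective (cong proj₂ (values rp))
  }
  where
  open ≡-Reasoning
  s = suc (suc s′)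
  padded = replicate s false ++ ds
  shift : ∀ i → i - lo ≡ (i ℤ.+ + W) - + s
  shift i = trans (ring i lo (+ W)) (cong (λ z → (i ℤ.+ + W) - z) e)
    where
    ring : ∀ i lo w → i - lo ≡ (i ℤ.+ w) - (lo ℤ.+ w)
    ring = solve-∀ℤ
  values : ∀ {N} → Represents N (rep lo ds) →
           (+ wsum fibPrev (nth padded) (length padded) , + wsum fib (nth padded) (length padded)) ≡
           (+ (N * fibPrev W) , + (N * fib W))
  values {N} rp = begin
    _                                          ≡⟨ sym (horner-applyUpTo (nth padded) (length padded)) ⟩
    horner (applyUpTo (nth padded) (length padded)) ≡⟨ cong horner (applyUpTo-nth padded) ⟩
    horner padded                              ≡⟨ horner-pad s ds ⟩
    iter s mulφ (horner ds)                    ≡⟨ sym (iter-scaleφ lo W s e (horner ds)) ⟩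
    iter W mulφ (value (rep lo ds))            ≡⟨ cong (iter W mulφ) rp ⟩
    iter W mulφ (+ N , + 0)                    ≡⟨ iter-mulφ N W ⟩
    _                                          ∎

normalized lo ds W (suc zero) (s≤s ()) _

normalize : ∀ r {V} → ℤ.∣ low r ∣ ≤ V → Normalized r (2 + V)
normalize (rep (+ k) ds) {V} _ =
  normalized (+ k) ds (2 + V) (k + (2 + V)) (≤-trans (s≤s (s≤s z≤n)) (m≤n+m (2 + V) k)) refl
normalize (rep -[1+ k ] ds) {V} 1+k≤V = normalized -[1+ k ] ds (2 + V) (2 + (V ∸ suc k)) (s≤s (s≤s z≤n))
  (trans (ℤP.⊖-≥ (≤-trans 1+k≤V (m≤n+m V 2))) (cong +_ (+-∸-assoc 2 1+k≤V)))

-- Canonical digits below index 0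

zeckendorf-normalized : ∀ {N r W} (n : Normalized r W) → IsBergman N r → Zeckendorf (Normalized.f n)
zeckendorf-normalized n (_ , nb) = record
  { noAdjacent = Shifted.noAdjacent⇐ digit≡ nb ; zero-0 = zero-0 ; zero-1 = zero-1 }
  where open Normalized n

bergman-digits-unique : ∀ {N r s} → IsBergman N r → IsBergman N s → ∀ i → digit r i ≡ digit s i
bergman-digits-unique {N} {r} {s} br bs i =
  trans (digit≡ nr i) (trans (extend-cong fr≗fs (i ℤ.+ + _)) (sym (digit≡ ns i)))
  where
  open Normalized
  nr = normalize r (m≤m+n ℤ.∣ low r ∣ ℤ.∣ low s ∣)
  ns = normalize s (m≤n+m ℤ.∣ low s ∣ ℤ.∣ low r ∣)
  fr≗fs : ∀ p → f nr p ≡ f ns p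
  fr≗fs = zeckendorf-unique′ (zeckendorf-normalized nr br) (zeckendorf-normalized ns bs)
            (vanishes nr) (vanishes ns) (trans (proj₂ (expands nr (proj₁ br))) (sym (proj₂ (expands ns (proj₁ bs)))))

-- Carrying the 1 1 of s upwards yields β(N), by Zeckendorf uniqueness, and never
-- moves a digit below index 0.
special-vs-bergman : ∀ {N s β} → IsSpecial N s → IsBergman N β →
                     (∀ k → digit s -[1+ k ] ≡ digit β -[1+ k ]) ×
                     (∀ {V} (n : Normalized β (suc V)) → CarryShape (Normalized.f n) (suc V))
special-vs-bergman {N} {s} {β} (rs , d1 , d0 , nb) bβ = negatives , shape
  where
  open Normalized
  V = ℤ.∣ low s ∣ + ℤ.∣ low β ∣
  W = 2 + V
  ns = normalize s (m≤m+n ℤ.∣ low s ∣ ℤ.∣ low β ∣)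
  nβ = normalize β (m≤n+m ℤ.∣ low β ∣ ℤ.∣ low s ∣)
  d-1 : digit s -[1+ 0 ] ≡ false
  d-1 with digit s -[1+ 0 ] in e
  ... | false = refl
  ... | true = ⊥-elim (nb -[1+ 0 ] (λ ()) (e , d0))
  C = carry (T ns) W (m≤m+n (T ns) W) (vanishes ns)
            (Shifted.noAdjacentExcept⇐ (digit≡ ns) nb)
            (trans (sym (digit≡ ns (+ 0))) d0) (trans (sym (digit≡ ns (+ 1))) d1)
  open Carried C renaming (result to h; vanishes to h-vanishes)
  zh : Zeckendorf h
  zh = record
    { noAdjacent = noAdjacent
    ; zero-0 = trans (agree-below 0 (s≤s z≤n)) (zero-0 ns)
    ; zero-1 = trans (agree-below 1 (s≤s (s≤s z≤n))) (zero-1 ns)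
    }
  h≗fβ : ∀ p → h p ≡ f nβ p
  h≗fβ = zeckendorf-unique′ zh (zeckendorf-normalized nβ bβ) h-vanishes (vanishes nβ)
           (trans (same-wsum fib-fibLike) (trans (wsum-vanishes fib 1 (vanishes ns))
             (trans (proj₂ (expands ns rs)) (sym (proj₂ (expands nβ (proj₁ bβ)))))))
  negatives : ∀ k → digit s -[1+ k ] ≡ digit β -[1+ k ]
  negatives k = begin
    digit s -[1+ k ]                       ≡⟨ digit≡ ns -[1+ k ] ⟩
    extend (f ns) (-[1+ k ] ℤ.+ + W)       ≡⟨ extend-below (λ p p<W → sym (agree-below p p<W)) k ⟩
    extend h (-[1+ k ] ℤ.+ + W)            ≡⟨ extend-cong h≗fβ (-[1+ k ] ℤ.+ + W) ⟩
    extend (f nβ) (-[1+ k ] ℤ.+ + W)       ≡⟨ sym (digit≡ nβ -[1+ k ]) ⟩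
    digit β -[1+ k ]                       ∎
    where open ≡-Reasoning
  shape : ∀ {V} (n : Normalized β (suc V)) → CarryShape (f n) (suc V)
  shape n = carryShape-transport
    (λ i → trans (extend-cong h≗fβ (i ℤ.+ + W)) (trans (sym (digit≡ nβ i)) (digit≡ n i)))
    ((λ { p refl → trans (agree-below (1 + V) ≤-refl) (trans (sym (digit≡ ns -[1+ 0 ])) d-1) }) ,
     zero-q , zero-1+q , then-one)

special-from-shape : ∀ {N β V} → IsBergman N β → (n : Normalized β (suc V)) →
                     CarryShape (Normalized.f n) (suc V) → ∃ (IsSpecial N)
special-from-shape {N} {β} {V} bβ n (zb , f0 , f1 , rest) =
  toRep (suc V) (T n) g ,
  special-toRep g-vanishes noAdjacentExcept one-q one-1+q
    (trans (same-wsum fibPrev-fibLike) (proj₁ ex) , trans (same-wsum fib-fibLike) (proj₂ ex))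
  where
  open Normalized
  open Uncarried (uncarry (vanishes n) (Zeckendorf.noAdjacent (zeckendorf-normalized n bβ)) zb f0 f1 rest)
    renaming (result to g; vanishes to g-vanishes)
  ex = expands n (proj₁ bβ)

canonical-exists : ∀ {N β} → IsBergman N β → ∃ (IsCanonical N)
canonical-exists {N} {β} bβ = decide (carryShape? (Normalized.vanishes n) (suc ℤ.∣ low β ∣))
  where
  n = normalize β ≤-refl
  decide : Dec (CarryShape (Normalized.f n) (2 + ℤ.∣ low β ∣)) → ∃ (IsCanonical N)
  decide (yes shape) = let (s , sp) = special-from-shape bβ n shape in s , inj₁ sp
  decide (no ¬shape) = β , inj₂ ((λ (s , sp) → ¬shape (proj₂ (special-vs-bergman sp bβ) n)) , bβ)

cdigit-negative : ∀ {N β} → IsBergman N β → ∀ k → CDigit N -[1+ k ] (digit β -[1+ k ])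
cdigit-negative bβ k = canonical-exists bβ , λ where
  r (inj₁ sp) → proj₁ (special-vs-bergman sp bβ) k
  r (inj₂ (_ , br)) → bergman-digits-unique br bβ -[1+ k ]

Sparse : ℕ → List ℕ → ℕ → Set
Sparse b [] c = b ≤ c
Sparse b (x ∷ xs) c = b ≤ x × Sparse (2 + x) xs c

sparse-bound : ∀ {b} xs {c} → Sparse b xs c → b ≤ c
sparse-bound [] b≤c = b≤c
sparse-bound (x ∷ xs) (b≤x , sp) = ≤-trans b≤x (≤-trans (m≤n+m x 2) (sparse-bound xs sp))

sparse-lower : ∀ {b b′} xs {c} → b′ ≤ b → Sparse b xs c → Sparse b′ xs c
sparse-lower [] b′≤b b≤c = ≤-trans b′≤b b≤c
sparse-lower (x ∷ xs) b′≤b (b≤x , sp) = ≤-trans b′≤b b≤x , sp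

sparse-upper : ∀ {b} xs {c c′} → c ≤ c′ → Sparse b xs c → Sparse b xs c′
sparse-upper [] c≤c′ b≤c = ≤-trans b≤c c≤c′
sparse-upper (x ∷ xs) c≤c′ (b≤x , sp) = b≤x , sparse-upper xs c≤c′ sp

sparse-++ : ∀ {b} xs {c ys d} → Sparse b xs c → Sparse c ys d → Sparse b (xs ++ ys) d
sparse-++ [] {ys = ys} b≤c sp = sparse-lower ys b≤c sp
sparse-++ (x ∷ xs) (b≤x , sp) sp′ = b≤x , sparse-++ xs sp sp′

member : List ℕ → ℕ → Bool
member [] _ = false
member (x ∷ xs) = member xs [ x ≔ true ]

member-bounds : ∀ {b} xs {c p} → Sparse b xs c → member xs p ≡ true → b ≤ p × 2 + p ≤ c
member-bounds (x ∷ xs) {p = p} (b≤x , sp) px with p ≟ x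
... | yes refl = b≤x , sparse-bound xs sp
... | no _ = ≤-trans b≤x (≤-trans (m≤n+m x 2) (proj₁ bounds)) , proj₂ bounds
  where
  bounds = member-bounds xs sp px

member-below : ∀ {b} xs {c p} → Sparse b xs c → p < b → member xs p ≡ false
member-below xs {p = p} sp p<b with member xs p in px
... | false = refl
... | true = ⊥-elim (<⇒≱ p<b (proj₁ (member-bounds xs sp px)))

member-vanishes : ∀ {b} xs {c} → Sparse b xs c → Vanishes c (member xs)
member-vanishes xs {c} sp p c≤p with member xs p in px
... | false = refl
... | true = ⊥-elim (<⇒≱ (≤-trans (m≤n+m (suc p) 1) (proj₂ (member-bounds xs sp px))) c≤p)

member-head : ∀ x xs → member (x ∷ xs) x ≡ true
member-head x xs = update-≡ (member xs) x true

sparse-noAdjacent : ∀ {b} xs {c} → Sparse b xs c → NoAdjacent (member xs)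
sparse-noAdjacent (x ∷ xs) (_ , sp) p px with p ≟ x
... | yes refl = trans (update-≢ (member xs) true (≢-sym n≢1+n)) (member-below xs sp (n<1+n (suc p)))
... | no p≢x = trans (update-≢ (member xs) true 1+p≢x) (sparse-noAdjacent xs sp p px)
  where
  1+p≢x : suc p ≢ x
  1+p≢x refl = 1+n≰n (≤-trans (m≤n+m (suc p) 2) (proj₁ (member-bounds xs sp px)))

member-++-false : ∀ xs {ys p} → member xs p ≡ false → member ys p ≡ false → member (xs ++ ys) p ≡ false
member-++-false [] _ ys-p = ys-p
member-++-false (x ∷ xs) {p = p} xs-p ys-p with p ≟ x
... | yes refl = ⊥-elim (true≢false xs-p)
... | no p≢x = member-++-false xs xs-p ys-p

member-1+a : ∀ a d zs {c} → Sparse (a + 2 * d) ((a + 2 * d) ∷ zs) c → member ((a + 2 * d) ∷ zs) (1 + a) ≡ false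
member-1+a a zero zs sp =
  subst (λ p → member ((a + 0) ∷ zs) p ≡ false) (cong suc (+-identityʳ a))
        (sparse-noAdjacent ((a + 0) ∷ zs) sp (a + 0) (member-head (a + 0) zs))
member-1+a a (suc d) zs sp =
  member-below ((a + 2 * suc d) ∷ zs) sp (subst (_< a + 2 * suc d) (+-comm a 1) (+-monoʳ-< a (*-monoʳ-≤ 2 (s≤s z≤n))))

wsum-member : ∀ w {b} xs {c T} → Sparse b xs c → c ≤ suc T → wsum w (member xs) T ≡ sum (map w xs)
wsum-member w [] {T = T} _ _ = wsum-false w T
wsum-member w (x ∷ xs) {T = T} (_ , sp) c≤1+T = begin
  wsum w (member xs [ x ≔ true ]) T  ≡⟨ wsum-insert w (member xs) T (member-below xs sp (m<n+m x {2} (s≤s z≤n))) x<T ⟩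
  w x + wsum w (member xs) T         ≡⟨ cong (_+_ (w x)) (wsum-member w xs sp c≤1+T) ⟩
  w x + sum (map w xs)               ∎
  where
  open ≡-Reasoning
  x<T : x < T
  x<T = ≤-pred (≤-trans (sparse-bound xs sp) c≤1+T)

sum-map-++ : ∀ (w : ℕ → ℕ) xs ys → sum (map w (xs ++ ys)) ≡ sum (map w xs) + sum (map w ys)
sum-map-++ w xs ys = trans (cong sum (map-++ w xs ys)) (sum-++ (map w xs) (map w ys))

cdigit-from-positions : ∀ {N e b} c xs → 4 ≤ c → Sparse 2 xs (2 + e) →
                        (∀ {w} → FibLike w → sum (map w xs) ≡ N * w (2 + c)) → member xs 5 ≡ b →
                        CDigit N (+ 3 - + c) b
cdigit-from-positions {N} {e} c@(suc (suc (suc (suc k)))) xs _ sp sum≡ m5 =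
  subst (CDigit N -[1+ k ]) digit≡b (cdigit-negative bβ k)
  where
  W = 2 + c
  T = 2 + e
  bβ : IsBergman N (toRep W T (member xs))
  bβ = bergman-toRep (member-vanishes xs sp) (sparse-noAdjacent xs sp)
    (trans (wsum-member fibPrev xs sp (n≤1+n T)) (sum≡ fibPrev-fibLike) ,
     trans (wsum-member fib xs sp (n≤1+n T)) (sum≡ fib-fibLike))
  ring : ∀ x → (ℤ.- (+ 1 ℤ.+ x)) ℤ.+ (+ 6 ℤ.+ x) ≡ + 5
  ring = solve-∀ℤ
  digit≡b : digit (toRep W T (member xs)) -[1+ k ] ≡ _
  digit≡b = trans (digit-toRep {W} {T} (member-vanishes xs sp) -[1+ k ]) (trans (cong (extend (member xs)) (ring (+ k))) m5)
cdigit-from-positions (suc zero) xs (s≤s ()) _ _ _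
cdigit-from-positions (suc (suc zero)) xs (s≤s (s≤s ())) _ _ _
cdigit-from-positions (suc (suc (suc zero))) xs (s≤s (s≤s (s≤s ()))) _ _ _

-- Lucas numbers and the expansions β(M)

Lᵉ Lᵒ : ℕ → ℕ
Lᵉ zero = 2
Lᵉ (suc n) = Lᵒ n + Lᵉ n
Lᵒ zero = 1
Lᵒ (suc n) = Lᵉ (suc n) + Lᵒ n

L-even-odd : ∀ n → L (2 * n) ≡ Lᵉ n × L (2 * n + 1) ≡ Lᵒ n
L-even-odd zero = refl , refl
L-even-odd (suc n) = even , odd
  where
  index₁ : ∀ n → 2 * suc n ≡ 2 + 2 * n
  index₁ = solve-∀
  index₂ : ∀ n → 2 * n + 1 ≡ 1 + 2 * n
  index₂ = solve-∀
  index₃ : ∀ n → 2 * suc n + 1 ≡ 3 + 2 * n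
  index₃ = solve-∀
  even : L (2 * suc n) ≡ Lᵉ (suc n)
  even = trans (cong L (index₁ n))
    (cong₂ _+_ (trans (cong L (sym (index₂ n))) (proj₂ (L-even-odd n))) (proj₁ (L-even-odd n)))
  odd : L (2 * suc n + 1) ≡ Lᵒ (suc n)
  odd = trans (cong L (index₃ n))
    (cong₂ _+_ (trans (cong L (sym (index₁ n))) even) (trans (cong L (sym (index₂ n))) (proj₂ (L-even-odd n))))

Lᵉ-positive : ∀ n → 1 ≤ Lᵉ n
Lᵉ-positive zero = s≤s z≤n
Lᵉ-positive (suc n) = ≤-trans (Lᵉ-positive n) (m≤n+m (Lᵉ n) (Lᵒ n))

<Lᵉ⇒≤Lᵒ : ∀ n {M} → M < Lᵉ n → M ≤ Lᵒ n
<Lᵉ⇒≤Lᵒ zero M<2 = ≤-pred M<2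
<Lᵉ⇒≤Lᵒ (suc n) M< = ≤-trans (<⇒≤ M<) (m≤m+n (Lᵉ (suc n)) (Lᵒ n))

Lᵒ<Lᵉ : ∀ k → Lᵒ k < Lᵉ (suc k)
Lᵒ<Lᵉ k = subst (_≤ Lᵉ (suc k)) (+-comm (Lᵒ k) 1) (+-monoʳ-≤ (Lᵒ k) (Lᵉ-positive k))

-- φ^(2n) + φ^(-2n) = L (2n)  and  φ^(2n+1) - φ^(-2n-1) = L (2n+1), multiplied by φ^(a+2n)
LucasEven LucasOdd : (ℕ → ℕ) → ℕ → Set
LucasEven w n = ∀ a → w (a + 4 * n) + w a ≡ Lᵉ n * w (a + 2 * n)
LucasOdd w n = ∀ a → w (a + 4 * n + 2) ≡ Lᵒ n * w (a + 2 * n + 1) + w a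

module _ {w : ℕ → ℕ} (fl : FibLike w) {n : ℕ} where
  private
    open ≡-Reasoning
    i₁ : ∀ a n → a + 4 * suc n ≡ 2 + (a + 4 * n + 2)
    i₁ = solve-∀
    i₂ : ∀ a n → a + 4 * n + 2 ≡ (2 + a) + 4 * n
    i₂ = solve-∀
    i₃ : ∀ a n → (1 + a) + 2 * n + 1 ≡ a + 2 * suc n
    i₃ = solve-∀
    i₄ : ∀ a n → (2 + a) + 2 * n ≡ a + 2 * suc n
    i₄ = solve-∀
    i₅ : ∀ a n → a + 4 * suc n + 2 ≡ 2 + (a + 4 * suc n)
    i₅ = solve-∀
    i₆ : ∀ a n → a + 4 * suc n ≡ (2 + a) + 4 * n + 2
    i₆ = solve-∀
    i₇ : ∀ a n → (1 + a) + 2 * suc n ≡ a + 2 * suc n + 1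
    i₇ = solve-∀
    i₈ : ∀ a n → (2 + a) + 2 * n + 1 ≡ a + 2 * suc n + 1
    i₈ = solve-∀
    regroup₁ : ∀ x b z a → x + b + z + a ≡ x + (z + (b + a))
    regroup₁ = solve-∀
    regroup₂ : ∀ p x b a → p + (x + (b + a)) ≡ p + b + x + a
    regroup₂ = solve-∀

  lucas-even-step : LucasEven w n → LucasOdd w n → LucasEven w (suc n)
  lucas-even-step even odd a = begin
    w (a + 4 * suc n) + w a
      ≡⟨ cong (_+ w a) (trans (cong w (i₁ a n)) (fl _)) ⟩
    w ((1 + a) + 4 * n + 2) + w z + w a
      ≡⟨ cong (λ y → y + w z + w a) (odd (1 + a)) ⟩
    Lᵒ n * w ((1 + a) + 2 * n + 1) + w (1 + a) + w z + w a
      ≡⟨ regroup₁ (Lᵒ n * w ((1 + a) + 2 * n + 1)) (w (1 + a)) (w z) (w a) ⟩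
    Lᵒ n * w ((1 + a) + 2 * n + 1) + (w z + (w (1 + a) + w a))
      ≡⟨ cong (λ y → Lᵒ n * w ((1 + a) + 2 * n + 1) + (w z + y)) (sym (fl a)) ⟩
    Lᵒ n * w ((1 + a) + 2 * n + 1) + (w z + w (2 + a))
      ≡⟨ cong (_+_ (Lᵒ n * w ((1 + a) + 2 * n + 1)))
              (trans (cong (λ i → w i + w (2 + a)) (i₂ a n)) (even (2 + a))) ⟩
    Lᵒ n * w ((1 + a) + 2 * n + 1) + Lᵉ n * w ((2 + a) + 2 * n)
      ≡⟨ cong₂ (λ i j → Lᵒ n * w i + Lᵉ n * w j) (i₃ a n) (i₄ a n) ⟩
    Lᵒ n * w (a + 2 * suc n) + Lᵉ n * w (a + 2 * suc n)
      ≡⟨ sym (*-distribʳ-+ (w (a + 2 * suc n)) (Lᵒ n) (Lᵉ n)) ⟩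
    Lᵉ (suc n) * w (a + 2 * suc n) ∎
    where
    z = a + 4 * n + 2

  lucas-odd-step : LucasOdd w n → LucasEven w (suc n) → LucasOdd w (suc n)
  lucas-odd-step odd even′ a = begin
    w (a + 4 * suc n + 2)
      ≡⟨ trans (cong w (i₅ a n)) (fl _) ⟩
    w ((1 + a) + 4 * suc n) + w (a + 4 * suc n)
      ≡⟨ cong (_+_ (w ((1 + a) + 4 * suc n))) (trans (cong w (i₆ a n)) (odd (2 + a))) ⟩
    w ((1 + a) + 4 * suc n) + (Lᵒ n * w ((2 + a) + 2 * n + 1) + w (2 + a))
      ≡⟨ cong (λ y → w ((1 + a) + 4 * suc n) + (Lᵒ n * w ((2 + a) + 2 * n + 1) + y)) (fl a) ⟩
    w ((1 + a) + 4 * suc n) + (Lᵒ n * w ((2 + a) + 2 * n + 1) + (w (1 + a) + w a))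
      ≡⟨ regroup₂ (w ((1 + a) + 4 * suc n)) (Lᵒ n * w ((2 + a) + 2 * n + 1)) (w (1 + a)) (w a) ⟩
    w ((1 + a) + 4 * suc n) + w (1 + a) + Lᵒ n * w ((2 + a) + 2 * n + 1) + w a
      ≡⟨ cong (λ y → y + Lᵒ n * w ((2 + a) + 2 * n + 1) + w a) (even′ (1 + a)) ⟩
    Lᵉ (suc n) * w ((1 + a) + 2 * suc n) + Lᵒ n * w ((2 + a) + 2 * n + 1) + w a
      ≡⟨ cong₂ (λ i j → Lᵉ (suc n) * w i + Lᵒ n * w j + w a) (i₇ a n) (i₈ a n) ⟩
    Lᵉ (suc n) * w (a + 2 * suc n + 1) + Lᵒ n * w (a + 2 * suc n + 1) + w a
      ≡⟨ cong (_+ w a) (sym (*-distribʳ-+ (w (a + 2 * suc n + 1)) (Lᵉ (suc n)) (Lᵒ n))) ⟩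
    Lᵒ (suc n) * w (a + 2 * suc n + 1) + w a ∎

lucas : ∀ {w} → FibLike w → ∀ n → LucasEven w n × LucasOdd w n
lucas {w} fl zero = even , odd
  where
  even : LucasEven w 0
  even a rewrite +-identityʳ a = cong (_+_ (w a)) (sym (+-identityʳ (w a)))
  odd : LucasOdd w 0
  odd a rewrite +-identityʳ a =
    trans (cong w (+-comm a 2)) (trans (fl a) (cong₂ _+_ (trans (cong w (+-comm 1 a)) (sym (+-identityʳ _))) refl))
lucas {w} fl (suc n) = even′ , lucas-odd-step fl {n} odd even′
  where
  odd = proj₂ (lucas {w} fl n)
  even′ = lucas-even-step fl {n} (proj₁ (lucas {w} fl n)) odd

chain : ℕ → ℕ → List ℕ
chain a zero = []
chain a (suc d) = suc a ∷ chain (2 + a) d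

chain-sum : ∀ {w} → FibLike w → ∀ a d → w a + sum (map w (chain a d)) ≡ w (a + 2 * d)
chain-sum {w} fl a zero = trans (+-identityʳ (w a)) (cong w (sym (+-identityʳ a)))
chain-sum {w} fl a (suc d) = begin
  w a + (w (suc a) + S)     ≡⟨ sym (+-assoc (w a) _ S) ⟩
  w a + w (suc a) + S       ≡⟨ cong (_+ S) (trans (+-comm (w a) _) (sym (fl a))) ⟩
  w (2 + a) + S             ≡⟨ chain-sum fl (2 + a) d ⟩
  w (2 + a + 2 * d)         ≡⟨ cong w (index a d) ⟩
  w (a + 2 * suc d)         ∎
  where
  open ≡-Reasoning
  S = sum (map w (chain (2 + a) d))
  index : ∀ a d → 2 + a + 2 * d ≡ a + 2 * suc d
  index = solve-∀

chain-sparse : ∀ a d → Sparse (suc a) (chain a d) (suc (a + 2 * d))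
chain-sparse a zero = s≤s (m≤m+n a 0)
chain-sparse a (suc d) = ≤-refl , sparse-upper (chain (2 + a) d) (s≤s (≤-reflexive (index a d))) (chain-sparse (2 + a) d)
  where
  index : ∀ a d → 2 + a + 2 * d ≡ a + 2 * suc d
  index = solve-∀

member-chain : ∀ a d ys → 1 ≤ d → member (chain a d ++ ys) (suc a) ≡ true
member-chain a (suc d) ys _ = member-head (suc a) (chain (2 + a) d ++ ys)

lucas-pair-sparse : ∀ m n → Sparse m (m ∷ (m + 4 * suc n) ∷ []) (m + 4 * suc n + 2)
lucas-pair-sparse m n =
  ≤-refl ,
  ≤-trans (≤-reflexive (+-comm 2 m)) (+-monoʳ-≤ m (≤-trans (s≤s (s≤s z≤n)) (*-monoʳ-≤ 4 (s≤s z≤n)))) ,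
  ≤-reflexive (+-comm 2 (m + 4 * suc n))

lucas-pair-sum : ∀ {w} → FibLike w → ∀ m n →
                 sum (map w (m ∷ (m + 4 * suc n) ∷ [])) ≡ Lᵉ (suc n) * w (m + 2 * suc n)
lucas-pair-sum {w} fl m n =
  trans (cong (_+_ (w m)) (+-identityʳ _)) (trans (+-comm (w m) _) (proj₁ (lucas {w} fl (suc n)) m))

-- β(M) for 1 ≤ M ≤ L (2n+1), on positions relative to an origin m, position p
-- standing for φ^(p - m - 2n): it lies in [-2n, 2n], its lowest exponent is
-- -2n + 2d, for n ≥ 1 that exponent is -2n exactly when M > L (2n-1), and for
-- M < L (2n) the exponents above the lowest one stay below 2n.
record Expansion (n M m : ℕ) : Set where
  field
    d : ℕ
    rest : List ℕ
    sparse : Sparse (m + 2 * d) ((m + 2 * d) ∷ rest) (m + 4 * n + 2)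
    sum≡ : ∀ {w} → FibLike w → sum (map w ((m + 2 * d) ∷ rest)) ≡ M * w (m + 2 * n)
    lowest-at-bottom : Lᵒ (pred n) < M → d ≡ 0
    lowest-above-bottom : 1 ≤ n → M ≤ Lᵒ (pred n) → 1 ≤ d
    rest-below-top : M < Lᵉ n → Sparse (m + 2 * d + 1) rest (m + 4 * n + 1)

Expansions : ℕ → Set
Expansions n = ∀ {M} → 1 ≤ M → M ≤ Lᵒ n → ∀ m → Expansion n M m

expansion : ∀ {n M m} d x rest → m + 2 * d ≡ x → Sparse x (x ∷ rest) (m + 4 * n + 2) →
            (∀ {w} → FibLike w → sum (map w (x ∷ rest)) ≡ M * w (m + 2 * n)) →
            (Lᵒ (pred n) < M → d ≡ 0) → (1 ≤ n → M ≤ Lᵒ (pred n) → 1 ≤ d) →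
            (M < Lᵉ n → Sparse (x + 1) rest (m + 4 * n + 1)) → Expansion n M m
expansion d _ rest refl sp val c₁ c₂ c₃ = record
  { d = d ; rest = rest ; sparse = sp ; sum≡ = val
  ; lowest-at-bottom = c₁ ; lowest-above-bottom = c₂ ; rest-below-top = c₃ }

record EvenExpansion (n M′ m : ℕ) : Set where
  field
    rest : List ℕ
    sparse : Sparse (2 + m) rest (m + 4 * suc n + 2)
    sum≡ : ∀ {w} → FibLike w → sum (map w (m ∷ rest)) ≡ (Lᵉ (suc n) + M′) * w (m + 2 * suc n)
    zero-3 : member (m ∷ rest) (3 + m) ≡ false

record OddExpansion (n M′ m : ℕ) : Set where
  field
    rest : List ℕ
    sparse : Sparse (2 + m) rest (m + 4 * suc n + 1)
    sum≡ : ∀ {w} → FibLike w → sum (map w (m ∷ rest)) ≡ (Lᵒ n + M′) * w (m + 2 * suc n)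
    one-3 : 1 ≤ n → M′ ≤ Lᵒ (pred n) → member (m ∷ rest) (3 + m) ≡ true
    zero-3 : Lᵒ (pred n) < M′ → member (m ∷ rest) (3 + m) ≡ false

lucas-even-sum : ∀ {w} → FibLike w → ∀ n m M′ xs → sum (map w xs) ≡ M′ * w (2 + m + 2 * n) →
                 sum (map w (m ∷ xs ++ (m + 4 * suc n) ∷ [])) ≡ (Lᵉ (suc n) + M′) * w (m + 2 * suc n)
lucas-even-sum {w} fl n m M′ xs sum≡ = begin
  w m + sum (map w (xs ++ t ∷ []))
    ≡⟨ cong (_+_ (w m)) (sum-map-++ w xs (t ∷ [])) ⟩
  w m + (sum (map w xs) + (w t + 0))
    ≡⟨ cong (λ y → w m + (y + (w t + 0))) (trans sum≡ (cong (λ i → M′ * w i) (index m n))) ⟩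
  w m + (M′ * w (m + 2 * suc n) + (w t + 0))
    ≡⟨ regroup (w m) (M′ * w (m + 2 * suc n)) (w t) ⟩
  w t + w m + M′ * w (m + 2 * suc n)
    ≡⟨ cong (_+ M′ * w (m + 2 * suc n)) (proj₁ (lucas {w} fl (suc n)) m) ⟩
  Lᵉ (suc n) * w (m + 2 * suc n) + M′ * w (m + 2 * suc n)
    ≡⟨ sym (*-distribʳ-+ (w (m + 2 * suc n)) (Lᵉ (suc n)) M′) ⟩
  (Lᵉ (suc n) + M′) * w (m + 2 * suc n) ∎
  where
  open ≡-Reasoning
  t = m + 4 * suc n
  index : ∀ m n → 2 + m + 2 * n ≡ m + 2 * suc n
  index = solve-∀
  regroup : ∀ a u b → a + (u + (b + 0)) ≡ b + a + u
  regroup = solve-∀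

-- φ^(-2n+2d) - φ^(-2n-1) = φ^(-2n-2) + φ^(-2n+1) + φ^(-2n+3) + … + φ^(-2n+2d-1)
lucas-odd-sum : ∀ {w} → FibLike w → ∀ n m d M′ rest →
                w (2 + m + 2 * d) + sum (map w rest) ≡ M′ * w (2 + m + 2 * n) →
                sum (map w (m ∷ chain (2 + m) d ++ rest ++ ((1 + m) + 4 * n + 2) ∷ [])) ≡
                (Lᵒ n + M′) * w (m + 2 * suc n)
lucas-odd-sum {w} fl n m d M′ rest sum≡ = begin
  w m + sum (map w (chain (2 + m) d ++ rest ++ t ∷ []))
    ≡⟨ cong (_+_ (w m)) (trans (sum-map-++ w (chain (2 + m) d) (rest ++ t ∷ []))
                                (cong (_+_ C) (sum-map-++ w rest (t ∷ [])))) ⟩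
  w m + (C + (R + (w t + 0)))
    ≡⟨ cong (λ y → w m + (C + (R + y))) (trans (+-identityʳ (w t)) (proj₂ (lucas {w} fl n) (1 + m))) ⟩
  w m + (C + (R + (Lᵒ n * w ((1 + m) + 2 * n + 1) + w (1 + m))))
    ≡⟨ regroup (w m) C R (Lᵒ n * w ((1 + m) + 2 * n + 1)) (w (1 + m)) ⟩
  w (1 + m) + w m + C + R + Lᵒ n * w ((1 + m) + 2 * n + 1)
    ≡⟨ cong (λ y → y + C + R + Lᵒ n * w ((1 + m) + 2 * n + 1)) (sym (fl m)) ⟩
  w (2 + m) + C + R + Lᵒ n * w ((1 + m) + 2 * n + 1)
    ≡⟨ cong (λ y → y + R + Lᵒ n * w ((1 + m) + 2 * n + 1)) (chain-sum {w} fl (2 + m) d) ⟩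
  w (2 + m + 2 * d) + R + Lᵒ n * w ((1 + m) + 2 * n + 1)
    ≡⟨ cong₂ _+_ (trans sum≡ (cong (λ i → M′ * w i) (index₁ m n))) (cong (λ i → Lᵒ n * w i) (index₂ m n)) ⟩
  M′ * w (m + 2 * suc n) + Lᵒ n * w (m + 2 * suc n)
    ≡⟨ trans (+-comm (M′ * w (m + 2 * suc n)) _) (sym (*-distribʳ-+ (w (m + 2 * suc n)) (Lᵒ n) M′)) ⟩
  (Lᵒ n + M′) * w (m + 2 * suc n) ∎
  where
  open ≡-Reasoning
  t = (1 + m) + 4 * n + 2
  C = sum (map w (chain (2 + m) d))
  R = sum (map w rest)
  index₁ : ∀ m n → 2 + m + 2 * n ≡ m + 2 * suc n
  index₁ = solve-∀
  index₂ : ∀ m n → (1 + m) + 2 * n + 1 ≡ m + 2 * suc n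
  index₂ = solve-∀
  regroup : ∀ a c r l b → a + (c + (r + (l + b))) ≡ b + a + c + r + l
  regroup = solve-∀

3+m≢m : ∀ m → 3 + m ≢ m
3+m≢m m = m+1+n≢n 2

even-expansion : ∀ {n M′} → Expansions n → 1 ≤ M′ → M′ ≤ Lᵒ n → ∀ m → EvenExpansion n M′ m
even-expansion {n} {M′} ex 1≤M′ M′≤ m = record
  { rest = zs
  ; sparse = sparse-lower zs (m≤m+n (2 + m) (2 * d)) zs-sparse
  ; sum≡ = λ {w} fl → lucas-even-sum fl n m M′ (x ∷ rest) (sum≡ {w} fl)
  ; zero-3 = trans (update-≢ (member zs) true (3+m≢m m)) (member-1+a (2 + m) d (rest ++ t ∷ []) zs-sparse)
  }
  where
  open Expansion (ex 1≤M′ M′≤ (2 + m))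
  x = 2 + m + 2 * d
  t = m + 4 * suc n
  zs = (x ∷ rest) ++ t ∷ []
  index₁ : ∀ m n → 2 + m + 4 * n + 2 ≡ m + 4 * suc n
  index₁ = solve-∀
  zs-sparse : Sparse x zs (m + 4 * suc n + 2)
  zs-sparse = sparse-++ (x ∷ rest) sparse (≤-reflexive (index₁ m n) , ≤-reflexive (+-comm 2 t))

odd-expansion : ∀ {n M′} → Expansions n → 1 ≤ M′ → M′ < Lᵉ n → ∀ m → OddExpansion n M′ m
odd-expansion {n} {M′} ex 1≤M′ M′< m = record
  { rest = zs
  ; sparse = sparse-lower zs (n≤1+n (2 + m)) zs-sparse
  ; sum≡ = λ {w} fl → lucas-odd-sum fl n m d M′ rest (sum≡ {w} fl)
  ; one-3 = λ 1≤n M′≤ → trans (update-≢ (member zs) true (3+m≢m m))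
                              (member-chain (2 + m) d tail (lowest-above-bottom 1≤n M′≤))
  ; zero-3 = zero-3
  }
  where
  open Expansion (ex 1≤M′ (<Lᵉ⇒≤Lᵒ n M′<) (2 + m))
  x = 2 + m + 2 * d
  t = (1 + m) + 4 * n + 2
  tail = rest ++ t ∷ []
  zs = chain (2 + m) d ++ tail
  index₁ : ∀ m n → 2 + m + 4 * n + 1 ≡ (1 + m) + 4 * n + 2
  index₁ = solve-∀
  index₂ : ∀ m n → 2 + ((1 + m) + 4 * n + 2) ≡ m + 4 * suc n + 1
  index₂ = solve-∀
  tail-sparse : Sparse (suc x) tail (m + 4 * suc n + 1)
  tail-sparse = sparse-lower tail (≤-reflexive (+-comm 1 x))
    (sparse-++ rest (rest-below-top M′<) (≤-reflexive (index₁ m n) , ≤-reflexive (index₂ m n)))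
  zs-sparse : Sparse (3 + m) zs (m + 4 * suc n + 1)
  zs-sparse = sparse-++ (chain (2 + m) d) (chain-sparse (2 + m) d) tail-sparse
  zero-3 : Lᵒ (pred n) < M′ → member (m ∷ zs) (3 + m) ≡ false
  zero-3 Lᵒ< rewrite lowest-at-bottom Lᵒ< = trans (update-≢ (member tail) true (3+m≢m m))
    (member-++-false rest (member-below rest (proj₂ sparse) (s≤s (s≤s (s≤s (s≤s (m≤m+n m (2 * d)))))))
                          (update-≢ (λ _ → false) true (3+m≢t n Lᵒ< M′<)))
    where
    3+m≢t : ∀ n → Lᵒ (pred n) < M′ → M′ < Lᵉ n → 3 + m ≢ (1 + m) + 4 * n + 2
    3+m≢t zero 1<M′ M′<2 = ⊥-elim (<⇒≱ M′<2 1<M′)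
    3+m≢t (suc n) _ _ = <⇒≢ (subst (3 + m <_) (index m n) (m<m+n (3 + m) {4 + 4 * n} (s≤s z≤n)))
      where
      index : ∀ m n → 3 + m + (4 + 4 * n) ≡ (1 + m) + 4 * suc n + 2
      index = solve-∀

expansion-shift : ∀ {n M m} → Expansion n M (2 + m) → M ≤ Lᵒ n → Expansion (suc n) M m
expansion-shift {n} {M} {m} E M≤Lᵒ = expansion (suc d) (2 + m + 2 * d) rest (index₁ m d)
  (sparse-upper (_ ∷ rest) (≤-trans (≤-reflexive (index₂ m n)) (m≤m+n _ 2)) sparse)
  (λ {w} fl → trans (sum≡ {w} fl) (cong (λ i → M * w i) (index₃ m n)))
  (λ Lᵒ<M → ⊥-elim (<⇒≱ Lᵒ<M M≤Lᵒ))
  (λ _ _ → s≤s z≤n)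
  (λ _ → sparse-lower rest (≤-trans (≤-reflexive (+-comm _ 1)) (n≤1+n _))
                           (sparse-upper rest (≤-trans (≤-reflexive (index₂ m n)) (m≤m+n _ 1)) (proj₂ sparse)))
  where
  open Expansion E
  index₁ : ∀ m d → m + 2 * suc d ≡ 2 + m + 2 * d
  index₁ = solve-∀
  index₂ : ∀ m n → 2 + m + 4 * n + 2 ≡ m + 4 * suc n
  index₂ = solve-∀
  index₃ : ∀ m n → 2 + m + 2 * n ≡ m + 2 * suc n
  index₃ = solve-∀

expansion-odd : ∀ {n M′ m} → OddExpansion n M′ m → 1 ≤ M′ → Expansion (suc n) (Lᵒ n + M′) m
expansion-odd {n} {M′} {m} O 1≤M′ = expansion 0 m rest (+-identityʳ m)
  (≤-refl , sparse-upper rest (+-monoʳ-≤ (m + 4 * suc n) (s≤s z≤n)) sparse)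
  sum≡
  (λ _ → refl)
  (λ _ ≤Lᵒ → ⊥-elim (<⇒≱ (m<m+n (Lᵒ n) 1≤M′) ≤Lᵒ))
  (λ _ → sparse-lower rest (≤-trans (≤-reflexive (+-comm m 1)) (n≤1+n _)) sparse)
  where open OddExpansion O

expansion-even : ∀ {n M′ m} → EvenExpansion n M′ m → Expansion (suc n) (Lᵉ (suc n) + M′) m
expansion-even {n} {M′} {m} E = expansion 0 m rest (+-identityʳ m) (≤-refl , sparse)
  sum≡
  (λ _ → refl)
  (λ _ ≤Lᵒ → ⊥-elim (<⇒≱ (<-≤-trans (Lᵒ<Lᵉ n) (m≤m+n (Lᵉ (suc n)) M′)) ≤Lᵒ))
  (λ <Lᵉ → ⊥-elim (<⇒≱ <Lᵉ (m≤m+n (Lᵉ (suc n)) M′)))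
  where open EvenExpansion E

expansion-pair : ∀ n m → Expansion (suc n) (Lᵉ (suc n)) m
expansion-pair n m = expansion 0 m ((m + 4 * suc n) ∷ []) (+-identityʳ m) (lucas-pair-sparse m n)
  (λ {w} fl → lucas-pair-sum {w} fl m n)
  (λ _ → refl)
  (λ _ ≤Lᵒ → ⊥-elim (<⇒≱ (Lᵒ<Lᵉ n) ≤Lᵒ))
  (λ <Lᵉ → ⊥-elim (<-irrefl refl <Lᵉ))

expansions : ∀ n → Expansions n
expansions zero {M} 1≤M M≤1 m with ≤-antisym M≤1 1≤M
... | refl = expansion 0 m [] (+-identityʳ m) (≤-refl , ≤-reflexive (index₁ m))
  (λ {w} _ → cong (λ i → w i + 0) (sym (+-identityʳ m)))
  (λ 1<1 → ⊥-elim (<-irrefl refl 1<1)) (λ ()) (λ _ → ≤-reflexive (index₂ m))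
  where
  index₁ : ∀ m → 2 + m ≡ m + 4 * 0 + 2
  index₁ = solve-∀
  index₂ : ∀ m → m + 1 ≡ m + 4 * 0 + 1
  index₂ = solve-∀
expansions (suc n) {M} 1≤M M≤ m with M ≤? Lᵒ n
... | yes M≤Lᵒ = expansion-shift (expansions n 1≤M M≤Lᵒ (2 + m)) M≤Lᵒ
... | no M≰Lᵒ with M <? Lᵉ (suc n)
...   | yes M<Lᵉ = subst (λ M → Expansion (suc n) M m) M≡
                     (expansion-odd (odd-expansion (expansions n) 1≤M′ M′<Lᵉ m) 1≤M′)
  where
  Lᵒ<M = ≰⇒> M≰Lᵒ
  M≡ = m+[n∸m]≡n (<⇒≤ Lᵒ<M)
  1≤M′ = m<n⇒0<n∸m Lᵒ<M
  M′<Lᵉ = +-cancelˡ-< (Lᵒ n) _ _ (subst (_< Lᵒ n + Lᵉ n) (sym M≡) M<Lᵉ)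
...   | no M≮Lᵉ with M ≟ Lᵉ (suc n)
...     | yes refl = expansion-pair n m
...     | no M≢Lᵉ = subst (λ M → Expansion (suc n) M m) M≡
                      (expansion-even (even-expansion (expansions n) (m<n⇒0<n∸m Lᵉ<M)
                                                      (m≤n+o⇒m∸n≤o M (Lᵉ (suc n)) M≤) m))
  where
  Lᵉ<M = ≤∧≢⇒< (≮⇒≥ M≮Lᵉ) (≢-sym M≢Lᵉ)
  M≡ = m+[n∸m]≡n (<⇒≤ Lᵉ<M)

-- The canonical digits in the Lucas intervals

L-2n+2 : ∀ n → L (2 * n + 2) ≡ Lᵉ (suc n)
L-2n+2 n = trans (cong L (index n)) (proj₁ (L-even-odd (suc n)))
  where
  index : ∀ n → 2 * n + 2 ≡ 2 * suc n
  index = solve-∀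

L-2n-1 : ∀ k → L (2 * suc k ∸ 1) ≡ Lᵒ k
L-2n-1 k = trans (cong L (trans (cong (_∸ 1) (index k)) (m+n∸m≡n 1 (2 * k + 1)))) (proj₂ (L-even-odd k))
  where
  index : ∀ k → 2 * suc k ≡ 1 + (2 * k + 1)
  index = solve-∀

L-2n-2 : ∀ k → L (2 * suc k ∸ 2) ≡ Lᵉ k
L-2n-2 k = trans (cong L (trans (cong (_∸ 2) (index k)) (m+n∸m≡n 2 (2 * k)))) (proj₁ (L-even-odd k))
  where
  index : ∀ k → 2 * suc k ≡ 2 + 2 * k
  index = solve-∀

index-shift : ∀ n → + 3 - + (2 * suc n) ≡ + 1 - + (2 * n)
index-shift n = trans (cong (λ z → + 3 - z) (cong +_ (index n))) (ring (+ (2 * n)))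
  where
  index : ∀ n → 2 * suc n ≡ 2 + 2 * n
  index = solve-∀
  ring : ∀ y → + 3 - (+ 2 ℤ.+ y) ≡ + 1 - y
  ring = solve-∀ℤ

4≤2*suc : ∀ {k} → 1 ≤ k → 4 ≤ 2 * suc k
4≤2*suc 1≤k = *-monoʳ-≤ 2 (s≤s 1≤k)

cdigit-even-interval : ∀ n N → 2 ≤ n → L (2 * n) < N → N ≤ L (2 * n + 1) →
                       CDigit N (+ 3 - + (2 * n)) false
cdigit-even-interval (suc k) N (s≤s 1≤k) L< ≤L =
  cdigit-from-positions (2 * suc k) (2 ∷ rest) (4≤2*suc 1≤k)
    (≤-refl , sparse-upper rest (≤-reflexive (+-assoc 2 (4 * suc k) 2)) sparse)
    (λ {w} fl → trans (sum≡ {w} fl) (cong (_* w (2 + 2 * suc k)) N≡)) zero-3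
  where
  Lᵉ<N : Lᵉ (suc k) < N
  Lᵉ<N = subst (_< N) (proj₁ (L-even-odd (suc k))) L<
  N≡ : Lᵉ (suc k) + (N ∸ Lᵉ (suc k)) ≡ N
  N≡ = m+[n∸m]≡n (<⇒≤ Lᵉ<N)
  open EvenExpansion (even-expansion (expansions k) (m<n⇒0<n∸m Lᵉ<N)
         (m≤n+o⇒m∸n≤o N (Lᵉ (suc k)) (subst (N ≤_) (proj₂ (L-even-odd (suc k))) ≤L)) 2)

module _ {n N : ℕ} (1≤n : 1 ≤ n) (Lᵒ<N : Lᵒ n < N) (N<Lᵉ : N < Lᵉ (suc n)) where
  private
    N≡ : Lᵒ n + (N ∸ Lᵒ n) ≡ N
    N≡ = m+[n∸m]≡n (<⇒≤ Lᵒ<N)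
    open OddExpansion (odd-expansion (expansions n) (m<n⇒0<n∸m Lᵒ<N)
           (+-cancelˡ-< (Lᵒ n) _ _ (subst (_< Lᵒ n + Lᵉ n) (sym N≡) N<Lᵉ)) 2)
    cdigit-odd : ∀ {b} → member (2 ∷ rest) 5 ≡ b → CDigit N (+ 1 - + (2 * n)) b
    cdigit-odd m5 = subst (λ i → CDigit N i _) (index-shift n)
      (cdigit-from-positions (2 * suc n) (2 ∷ rest) (4≤2*suc 1≤n)
        (≤-refl , sparse-upper rest (≤-reflexive (+-assoc 2 (4 * suc n) 1)) sparse)
        (λ {w} fl → trans (sum≡ {w} fl) (cong (_* w (2 + 2 * suc n)) N≡)) m5)

  cdigit-odd-interval-low : N ≤ Lᵒ n + Lᵒ (pred n) → CDigit N (+ 1 - + (2 * n)) true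
  cdigit-odd-interval-low N≤ = cdigit-odd (one-3 1≤n (m≤n+o⇒m∸n≤o N (Lᵒ n) N≤))

  cdigit-odd-interval-high : Lᵒ n + Lᵒ (pred n) < N → CDigit N (+ 1 - + (2 * n)) false
  cdigit-odd-interval-high <N =
    cdigit-odd (zero-3 (+-cancelˡ-< (Lᵒ n) _ _ (subst (Lᵒ n + Lᵒ (pred n) <_) (sym N≡) <N)))

cdigit-Lᵉ : ∀ {n} → 1 ≤ n → CDigit (Lᵉ (suc n)) (+ 1 - + (2 * n)) false
cdigit-Lᵉ {n} 1≤n = subst (λ i → CDigit (Lᵉ (suc n)) i false) (index-shift n)
  (cdigit-from-positions (2 * suc n) (2 ∷ t ∷ []) (4≤2*suc 1≤n)
    (sparse-upper (2 ∷ t ∷ []) (≤-reflexive (+-assoc 2 (4 * suc n) 2)) (lucas-pair-sparse 2 n))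
    (λ {w} fl → lucas-pair-sum {w} fl 2 n)
    (trans (update-≢ (member (t ∷ [])) {2} true {5} (λ ()))
           (update-≢ (λ _ → false) {t} true {5} (<⇒≢ (+-monoʳ-≤ 2 (*-monoʳ-≤ 4 {1} {suc n} (s≤s z≤n)))))))
  where
  t = 2 + 4 * suc n

cdigit-odd-interval-first : ∀ n → 1 ≤ n → ∀ N → L (2 * n + 1) < N → N ≤ L (2 * n + 1) + L (2 * n ∸ 1) →
                            CDigit N (+ 1 - + (2 * n)) true
cdigit-odd-interval-first (suc k) 1≤n N L< ≤L rewrite proj₂ (L-even-odd (suc k)) | L-2n-1 k =
  cdigit-odd-interval-low 1≤n L< (≤-<-trans ≤L (+-monoʳ-< (Lᵒ (suc k)) (Lᵒ<Lᵉ k))) ≤L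

cdigit-odd-interval-last : ∀ n → 1 ≤ n → ∀ N → L (2 * n + 2) ∸ L (2 * n ∸ 2) < N → N ≤ L (2 * n + 2) →
                           CDigit N (+ 1 - + (2 * n)) false
cdigit-odd-interval-last (suc k) 1≤n N L< ≤L rewrite L-2n+2 (suc k) | L-2n-2 k with N ≟ Lᵉ (suc (suc k))
... | yes refl = cdigit-Lᵉ 1≤n
... | no N≢ = cdigit-odd-interval-high 1≤n (≤-<-trans (m≤m+n (Lᵒ (suc k)) (Lᵒ k)) <N) (≤∧≢⇒< ≤L N≢) <N
  where
  <N : Lᵒ (suc k) + Lᵒ k < N
  <N = subst (_< N) (trans (cong (_∸ Lᵉ k) (sym (+-assoc (Lᵒ (suc k)) (Lᵒ k) (Lᵉ k))))
                           (m+n∸n≡m (Lᵒ (suc k) + Lᵒ k) (Lᵉ k))) L<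

lemma10 :
    ((n N : ℕ) → 2 ≤ n → L (2 * n) < N → N ≤ L (2 * n + 1) →
      CDigit N (+ 3 - + (2 * n)) false)
    ×
    ((n : ℕ) → 2 ≤ n →
      ((N : ℕ) → L (2 * n + 1) < N → N ≤ L (2 * n + 1) + L (2 * n ∸ 1) →
        CDigit N (+ 1 - + (2 * n)) true)
      ×
      ((N : ℕ) → L (2 * n + 2) ∸ L (2 * n ∸ 2) < N → N ≤ L (2 * n + 2) →
        CDigit N (+ 1 - + (2 * n)) false))
lemma10 = cdigit-even-interval , λ n 2≤n →
  cdigit-odd-interval-first n (1≤ 2≤n) , cdigit-odd-interval-last n (1≤ 2≤n)
  where
  1≤ : ∀ {n} → 2 ≤ n → 1 ≤ n
  1≤ = ≤-trans (s≤s z≤n)
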